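{- Let $L$ be a tabular quasi-normal modal logic. Let $f:\mathbb N\to\mathbb N$ be any function such that every propositional formula $\varphi$ has, for every $\sigma\subseteq\mathrm{sig}(\varphi)$, a propositional uniform $\sigma$-interpolant of size at most $f(|\varphi|)$. Then there are polynomials $p_1,p_2$ (depending only on $L$) such that every modal formula $\varphi$ has, for every $\sigma\subseteq\mathrm{sig}(\varphi)$, a strongest $L(\sigma)$-implicate of size at most $p_1(f(p_2(|\varphi|)))$.
   Context: Signatures are finite sets of atoms. PL: propositional formulas over atoms with $\top,\neg,\wedge$; ML: additionally $\Box$. $\mathrm{sig}(\varphi)$ is the set of atoms of $\varphi$. The size $|\varphi|$ of a formula is its number of distinct subformulas (dag-size). For a class $\mathcal F$ of pointed Kripke frames, $\mathrm{Log}(\mathcal F)$ is the set of modal formulas valid at the distinguished world of every member under all valuations. A quasi-normal modal logic is a set of modal formulas containing all formulas valid in all pointed frames, closed under modus ponens and uniform substitution; it is tabular if it equals $\mathrm{Log}(\mathcal F)$ for a finite set $\mathcal F$ of finite pointed frames. A strongest $L(\sigma)$-implicate of $\varphi$ is a modal $\chi$ with $\mathrm{sig}(\chi)\subseteq\sigma$, $\varphi\to\chi\in L$, and $\chi\to\psi\in L$ for all modal $\psi$ with $\mathrm{sig}(\psi)\subseteq\sigma$ and $\varphi\to\psi\in L$. A propositional uniform $\sigma$-interpolant of a propositional $\xi$ is a propositional $\chi$ with $\mathrm{sig}(\chi)\subseteq\sigma$, $\xi\to\chi$ a tautology, and $\chi\to\psi$ a tautology for every propositional $\psi$ with $\mathrm{sig}(\psi)\cap\mathrm{sig}(\xi)\subseteq\sigma$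 and $\xi\to\psi$ a tautology. -}

module Defs where

open import Data.Nat using (ℕ; zero; suc; _+_; _*_; _≤_)
open import Data.Bool using (Bool; true; false; _∧_; not; if_then_else_)
open import Data.Fin using (Fin)
open import Data.List using (List; []; _∷_; _++_; length; deduplicateᵇ; allFin)
open import Data.List.Membership.Propositional using (_∈_)
open import Data.List.Relation.Binary.Subset.Propositional using (_⊆_)
open import Data.List.Relation.Unary.All using (All)
open import Data.Product using (Σ; _×_)
open import Relation.Binary.PropositionalEquality using (_≡_)

Atom : Set
Atom = ℕ

Sig : Set
Sig = List Atom

data PForm : Set where
  pvar : Atom → PForm
  ptop : PForm
  pneg : PForm → PForm
  pand : PForm → PForm → PForm

psig : PForm → Sig
psig (pvar a)   = a ∷ []
psig ptop       = []
psig (pneg φ)   = psig φ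
psig (pand φ ψ) = psig φ ++ psig ψ

_==P_ : PForm → PForm → Bool
pvar a ==P pvar b = a Data.Nat.≡ᵇ b
ptop ==P ptop = true
pneg φ ==P pneg ψ = φ ==P ψ
pand φ₁ φ₂ ==P pand ψ₁ ψ₂ = (φ₁ ==P ψ₁) ∧ (φ₂ ==P ψ₂)
_ ==P _ = false

psubs : PForm → List PForm
psubs (pvar a)   = pvar a ∷ []
psubs ptop       = ptop ∷ []
psubs (pneg φ)   = pneg φ ∷ psubs φ
psubs (pand φ ψ) = pand φ ψ ∷ (psubs φ ++ psubs ψ)

-- dag-size: number of distinct subformulas
psize : PForm → ℕ
psize φ = length (deduplicateᵇ _==P_ (psubs φ))

pimp : PForm → PForm → PForm
pimp φ ψ = pneg (pand φ (pneg ψ))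

peval : (Atom → Bool) → PForm → Bool
peval v (pvar a)   = v a
peval v ptop       = true
peval v (pneg φ)   = not (peval v φ)
peval v (pand φ ψ) = peval v φ ∧ peval v ψ

Tautology : PForm → Set
Tautology φ = ∀ (v : Atom → Bool) → peval v φ ≡ true

IsUniformInterpolant : Sig → PForm → PForm → Set
IsUniformInterpolant σ ξ χ =
  (psig χ ⊆ σ) ×
  Tautology (pimp ξ χ) ×
  (∀ (ψ : PForm) →
     (∀ {a} → a ∈ psig ψ → a ∈ psig ξ → a ∈ σ) →
     Tautology (pimp ξ ψ) → Tautology (pimp χ ψ))

data MForm : Set where
  var : Atom → MForm
  top : MForm
  neg : MForm → MForm
  and : MForm → MForm → MForm
  box : MForm → MForm

msig : MForm → Sig
msig (var a)   = a ∷ []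
msig top       = []
msig (neg φ)   = msig φ
msig (and φ ψ) = msig φ ++ msig ψ
msig (box φ)   = msig φ

_==M_ : MForm → MForm → Bool
var a ==M var b = a Data.Nat.≡ᵇ b
top ==M top = true
neg φ ==M neg ψ = φ ==M ψ
and φ₁ φ₂ ==M and ψ₁ ψ₂ = (φ₁ ==M ψ₁) ∧ (φ₂ ==M ψ₂)
box φ ==M box ψ = φ ==M ψ
_ ==M _ = false

msubs : MForm → List MForm
msubs (var a)   = var a ∷ []
msubs top       = top ∷ []
msubs (neg φ)   = neg φ ∷ msubs φ
msubs (and φ ψ) = and φ ψ ∷ (msubs φ ++ msubs ψ)
msubs (box φ)   = box φ ∷ msubs φ

msize : MForm → ℕ
msize φ = length (deduplicateᵇ _==M_ (msubs φ))

imp : MForm → MForm → MForm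
imp φ ψ = neg (and φ (neg ψ))

msubst : (Atom → MForm) → MForm → MForm
msubst s (var a)   = s a
msubst s top       = top
msubst s (neg φ)   = neg (msubst s φ)
msubst s (and φ ψ) = and (msubst s φ) (msubst s ψ)
msubst s (box φ)   = box (msubst s φ)

allB : {A : Set} → (A → Bool) → List A → Bool
allB p []       = true
allB p (x ∷ xs) = p x ∧ allB p xs

record PFrame : Set where
  field
    n     : ℕ
    R     : Fin n → Fin n → Bool
    point : Fin n
open PFrame public

meval : (F : PFrame) → (Atom → Fin (n F) → Bool) → Fin (n F) → MForm → Bool
meval F V w (var a)   = V a w
meval F V w top       = true
meval F V w (neg φ)   = not (meval F V w φ)
meval F V w (and φ ψ) = meval F V w φ ∧ meval F V w ψ
meval F V w (box φ)   =
  allB (λ u → if R F w u then meval F V u φ else true) (allFin (n F))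

ValidAt : PFrame → MForm → Set
ValidAt F φ = ∀ (V : Atom → Fin (n F) → Bool) → meval F V (point F) φ ≡ true

Log : List PFrame → MForm → Set
Log Fs φ = All (λ F → ValidAt F φ) Fs

QuasiNormal : (MForm → Set) → Set
QuasiNormal L =
  (∀ φ → (∀ (F : PFrame) → ValidAt F φ) → L φ) ×
  (∀ φ ψ → L φ → L (imp φ ψ) → L ψ) ×
  (∀ φ (s : Atom → MForm) → L φ → L (msubst s φ))

Tabular : (MForm → Set) → Set
Tabular L = Σ (List PFrame) λ Fs → ∀ φ → (L φ → Log Fs φ) × (Log Fs φ → L φ)

IsStrongestImplicate : (MForm → Set) → Sig → MForm → MForm → Set
IsStrongestImplicate L σ φ χ =
  (msig χ ⊆ σ) ×
  L (imp φ χ) ×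
  (∀ (ψ : MForm) → msig ψ ⊆ σ → L (imp φ ψ) → L (imp χ ψ))

-- Polynomials with natural-number coefficients (c₀ ∷ c₁ ∷ …)

Poly : Set
Poly = List ℕ

evalPoly : Poly → ℕ → ℕ
evalPoly []       x = 0
evalPoly (c ∷ cs) x = c + x * evalPoly cs x

module Submission where

-- Let L = Log Fs, with every frame of Fs of size at most N. The σ-formulas Ψ (N * N), built from
-- the atoms of σ by taking ◇ of conjunctions of at most N literals, determine σ-equivalence on
-- pointed models of size at most N: whether two pointed models agree on Ψ (i + 1) controls
-- back-and-forth steps at level i, and the agreement relations on the at most N² pairs of worlds
-- shrink with i, so they become stable within N² rounds. Hence φ → ψ holds in L for a σ-formula ψ
-- exactly when ψ holds at every point of Fs whose Ψ-profile is that of a model of φ. Translating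
-- the semantics of φ and of Ψ over each frame into propositional logic gives a formula ξ of size
-- polynomial in |φ|, stating that some frame has a model of φ whose profile is recorded by fresh
-- atoms qⱼ; substituting Ψ for the qⱼ in a uniform interpolant of ξ over the qⱼ yields the strongest
-- L(σ)-implicate. The substitution costs an additive polynomial term, which is again bounded by f:
-- the uniform interpolant of p₀ ∧ … ∧ pₘ over all its atoms mentions each of them, so f(2m+1) > m.

open import Defs
open import Data.Nat using (ℕ; zero; suc; _+_; _*_; _^_; _∸_; _⊔_; _≤_; _<_; z≤n; s≤s; NonZero)
open import Data.Nat.Properties
import Data.Nat.Properties as ℕ
open import Data.Bool using (Bool; true; false; T; not; _∧_; if_then_else_)
import Data.Bool.Properties as Bool
open import Data.Empty using (⊥; ⊥-elim)
open import Data.Fin using (Fin; toℕ)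
import Data.Fin.Properties as Fin
open import Data.Fin.Properties using (toℕ<n; toℕ-injective)
open import Data.List using (List; []; _∷_; _++_; length; map; concatMap; filter; lookup; allFin; cartesianProductWith; cartesianProduct; deduplicate; deduplicateᵇ)
open import Data.List.Properties using (length-++; length-map; length-tabulate; length-filter; length-removeAt′; filter-≐)
open import Data.List.Membership.Propositional using (_∈_; _∉_; find; lose)
open import Data.List.Membership.Propositional.Properties
open import Data.List.Membership.DecPropositional ℕ._≟_ using (_∈?_)
open import Data.List.Relation.Binary.Pointwise using (Pointwise-≡⇒≡)
open import Data.List.Relation.Binary.Sublist.Propositional using (⊆-refl)
open import Data.List.Relation.Binary.Sublist.Propositional.Properties using (filter⁺; filter-⊆; length-mono-≤; to-≋)
open import Data.List.Relation.Binary.Subset.Propositional using (_⊆_)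
open import Data.List.Relation.Binary.Subset.Propositional.Properties using (∈-∷⁺ʳ)
open import Data.List.Relation.Unary.All as All using (All; []; _∷_)
import Data.List.Relation.Unary.All.Properties as All
open import Data.List.Relation.Unary.All.Properties using (¬All⇒Any¬)
open import Data.List.Relation.Unary.AllPairs using ([]; _∷_)
open import Data.List.Relation.Unary.Any as Any using (Any; here; there; any?; _─_)
import Data.List.Relation.Unary.Any.Properties as Any
open import Data.List.Relation.Unary.Unique.Propositional using (Unique)
import Data.List.Relation.Unary.Unique.Propositional.Properties as Unique
open import Data.List.Relation.Unary.Unique.DecPropositional.Properties using (deduplicate-!)
open import Data.Nat.DivMod using (_/_; _%_; [m+kn]%n≡m%n; m<n⇒m%n≡m; +-distrib-/; m<n⇒m/n≡0; m*n/n≡m; m*n%n≡0)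
open import Data.Nat.Solver using (module +-*-Solver)
open import Data.Product using (Σ; ∃-syntax; _×_; _,_; proj₁; proj₂)
open import Data.Sum using (_⊎_; inj₁; inj₂)
open import Function using (_∘_; id)
open import Function.Bundles using (Equivalence)
open import Function.Definitions using (Injective)
open import Level using (0ℓ)
open import Relation.Binary.Definitions using (DecidableEquality)
open import Relation.Binary.PropositionalEquality using (_≡_; _≢_; refl; sym; trans; cong; cong₂; subst; ≢-sym; module ≡-Reasoning)
open import Relation.Nullary using (Dec; yes; no; ¬_; ¬?; does; _×-dec_)
open import Relation.Nullary.Decidable using (map′; T?; dec-true; dec-false; decidable-stable)
open import Relation.Unary using (Pred; Decidable)

-- Counting and stabilisation on lists

module _ {A : Set} where

  ∈-─⁺ : ∀ {x z : A} {ys} (x∈ys : x ∈ ys) → z ∈ ys → z ≢ x → z ∈ (ys ─ x∈ys)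
  ∈-─⁺ (here refl) (here refl) z≢x = ⊥-elim (z≢x refl)
  ∈-─⁺ (here refl) (there z∈ys) _   = z∈ys
  ∈-─⁺ (there x∈ys) (here refl) _   = here refl
  ∈-─⁺ (there x∈ys) (there z∈ys) z≢x = there (∈-─⁺ x∈ys z∈ys z≢x)

  Unique-⊆⇒length≤ : ∀ {xs ys : List A} → Unique xs → xs ⊆ ys → length xs ≤ length ys
  Unique-⊆⇒length≤ [] _ = z≤n
  Unique-⊆⇒length≤ {x ∷ xs} {ys} (x≢xs ∷ !xs) xs⊆ys = begin
    suc (length xs)          ≤⟨ s≤s (Unique-⊆⇒length≤ !xs xs⊆ys─x) ⟩
    suc (length (ys ─ x∈ys)) ≡⟨ sym (length-removeAt′ ys (Any.index x∈ys)) ⟩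
    length ys                ∎
    where
    open ≤-Reasoning
    x∈ys = xs⊆ys (here refl)
    xs⊆ys─x : xs ⊆ (ys ─ x∈ys)
    xs⊆ys─x z∈xs = ∈-─⁺ x∈ys (xs⊆ys (there z∈xs)) (≢-sym (All.lookup x≢xs z∈xs))

  module _ (_≟_ : DecidableEquality A) where

    length-deduplicate-≤ : ∀ {xs ys} → xs ⊆ ys → length (deduplicate _≟_ xs) ≤ length ys
    length-deduplicate-≤ {xs} xs⊆ys = Unique-⊆⇒length≤ (deduplicate-! _≟_ xs) (xs⊆ys ∘ ∈-deduplicate⁻ _≟_ xs)

    Unique-⊆⇒≤length-deduplicate : ∀ {us xs} → Unique us → us ⊆ xs → length us ≤ length (deduplicate _≟_ xs)
    Unique-⊆⇒≤length-deduplicate !us us⊆xs = Unique-⊆⇒length≤ !us (∈-deduplicate⁺ _≟_ ∘ us⊆xs)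

module _ {A : Set} (_==_ : A → A → Bool) (_≟_ : DecidableEquality A)
         (==⇒≡ : ∀ x y → T (x == y) → x ≡ y) (==-refl : ∀ x → T (x == x)) where

  deduplicateᵇ-≗ : ∀ xs → deduplicateᵇ _==_ xs ≡ deduplicate _≟_ xs
  deduplicateᵇ-≗ [] = refl
  deduplicateᵇ-≗ (x ∷ xs) = cong (x ∷_) (begin
    filter (¬? ∘ T? ∘ (x ==_)) (deduplicateᵇ _==_ xs)
      ≡⟨ filter-≐ (¬? ∘ T? ∘ (x ==_)) (¬? ∘ (x ≟_)) (agree , agree⁻) (deduplicateᵇ _==_ xs) ⟩
    filter (¬? ∘ (x ≟_)) (deduplicateᵇ _==_ xs)
      ≡⟨ cong (filter _) (deduplicateᵇ-≗ xs) ⟩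
    filter (¬? ∘ (x ≟_)) (deduplicate _≟_ xs)
      ∎)
    where
    open ≡-Reasoning
    agree : ∀ {y} → ¬ T (x == y) → x ≢ y
    agree ¬x==y refl = ¬x==y (==-refl x)
    agree⁻ : ∀ {y} → x ≢ y → ¬ T (x == y)
    agree⁻ x≢y = x≢y ∘ ==⇒≡ x _

length-cartesianProductWith : ∀ {A B C : Set} (f : A → B → C) xs ys →
  length (cartesianProductWith f xs ys) ≡ length xs * length ys
length-cartesianProductWith f []       ys = refl
length-cartesianProductWith f (x ∷ xs) ys = begin
  length (map (f x) ys ++ cartesianProductWith f xs ys)
    ≡⟨ length-++ (map (f x) ys) ⟩
  length (map (f x) ys) + length (cartesianProductWith f xs ys)
    ≡⟨ cong₂ _+_ (length-map (f x) ys) (length-cartesianProductWith f xs ys) ⟩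
  length ys + length xs * length ys
    ∎
  where open ≡-Reasoning

length-allFin : ∀ n → length (allFin n) ≡ n
length-allFin n = length-tabulate {n = n} (λ i → i)

descending-stabilises : ∀ (c : ℕ → ℕ) m → (∀ i → c (suc i) ≤ c i) → c 0 ≤ m →
  ∃[ j ] (j ≤ m × c (suc j) ≡ c j)
descending-stabilises c m c↓ c₀≤m with c 1 ℕ.≟ c 0
... | yes c₁≡c₀ = 0 , z≤n , c₁≡c₀
descending-stabilises c zero c↓ c₀≤0 | no c₁≢c₀ =
  ⊥-elim (c₁≢c₀ (trans (n≤0⇒n≡0 (≤-trans (c↓ 0) c₀≤0)) (sym (n≤0⇒n≡0 c₀≤0))))
descending-stabilises c (suc m) c↓ c₀≤m | no c₁≢c₀ =
  let j , j≤m , cⱼ₊₁≡cⱼ = descending-stabilises (c ∘ suc) m (c↓ ∘ suc) c₁≤m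
  in suc j , s≤s j≤m , cⱼ₊₁≡cⱼ
  where
  c₁≤m : c 1 ≤ m
  c₁≤m = ≤-pred (≤-trans (≤∧≢⇒< (c↓ 0) c₁≢c₀) c₀≤m)

module _ {A : Set} {P Q : Pred A 0ℓ} (P? : Decidable P) (Q? : Decidable Q) (P⇒Q : ∀ {x} → P x → Q x) where

  length-filter-mono : ∀ xs → length (filter P? xs) ≤ length (filter Q? xs)
  length-filter-mono xs = length-mono-≤ (filter⁺ P? Q? (λ { refl → P⇒Q }) (⊆-refl {x = xs}))

  length-filter-≥⇒≡ : ∀ xs → length (filter Q? xs) ≤ length (filter P? xs) → filter P? xs ≡ filter Q? xs
  length-filter-≥⇒≡ xs Q≤P = Pointwise-≡⇒≡ (to-≋ (≤-antisym (length-mono-≤ P⊆Q) Q≤P) P⊆Q)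
    where P⊆Q = filter⁺ P? Q? (λ { refl → P⇒Q }) (⊆-refl {x = xs})

descending-chain-stabilises : ∀ {A : Set} (P : ℕ → Pred A 0ℓ) (P? : ∀ i → Decidable (P i)) →
  (∀ i {x} → P (suc i) x → P i x) → ∀ xs →
  ∃[ j ] (j ≤ length xs × ∀ {x} → x ∈ xs → P j x → P (suc j) x)
descending-chain-stabilises P P? P↓ xs =
  let j , j≤ , cⱼ₊₁≡cⱼ = descending-stabilises count (length xs) count↓ (length-mono-≤ (filter-⊆ (P? 0) xs))
  in j , j≤ , λ {x} x∈xs Pⱼx →
       let filter≡ = length-filter-≥⇒≡ (P? (suc j)) (P? j) (P↓ j) xs (≤-reflexive (sym cⱼ₊₁≡cⱼ))
       in proj₂ (∈-filter⁻ (P? (suc j)) {xs = xs} (subst (x ∈_) (sym filter≡) (∈-filter⁺ (P? j) x∈xs Pⱼx)))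
  where
  count : ℕ → ℕ
  count i = length (filter (P? i) xs)
  count↓ : ∀ i → count (suc i) ≤ count i
  count↓ i = length-filter-mono (P? (suc i)) (P? i) (P↓ i) xs

length-concatMap-≤ : ∀ {A B : Set} (f : A → List B) xs {b} → All (λ x → length (f x) ≤ b) xs →
  length (concatMap f xs) ≤ length xs * b
length-concatMap-≤ f []       []           = z≤n
length-concatMap-≤ f (x ∷ xs) (fx≤ ∷ fxs≤) =
  ≤-trans (≤-reflexive (length-++ (f x))) (+-mono-≤ fx≤ (length-concatMap-≤ f xs fxs≤))

-- Sizes and subformulas

==M-sound : ∀ φ ψ → T (φ ==M ψ) → φ ≡ ψ
==M-sound (var a)     (var b)     eq = cong var (≡ᵇ⇒≡ a b eq)
==M-sound top         top         eq = refl
==M-sound (neg φ)     (neg ψ)     eq = cong neg (==M-sound φ ψ eq)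
==M-sound (and φ₁ φ₂) (and ψ₁ ψ₂) eq =
  let eq₁ , eq₂ = Equivalence.to Bool.T-∧ eq in cong₂ and (==M-sound φ₁ ψ₁ eq₁) (==M-sound φ₂ ψ₂ eq₂)
==M-sound (box φ)     (box ψ)     eq = cong box (==M-sound φ ψ eq)

==M-refl : ∀ φ → T (φ ==M φ)
==M-refl (var a)   = ≡⇒≡ᵇ a a refl
==M-refl top       = _
==M-refl (neg φ)   = ==M-refl φ
==M-refl (and φ ψ) = Equivalence.from Bool.T-∧ (==M-refl φ , ==M-refl ψ)
==M-refl (box φ)   = ==M-refl φ

_≟ᴹ_ : DecidableEquality MForm
φ ≟ᴹ ψ = map′ (==M-sound φ ψ) (λ { refl → ==M-refl φ }) (T? (φ ==M ψ))

==P-sound : ∀ φ ψ → T (φ ==P ψ) → φ ≡ ψ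
==P-sound (pvar a)     (pvar b)     eq = cong pvar (≡ᵇ⇒≡ a b eq)
==P-sound ptop         ptop         eq = refl
==P-sound (pneg φ)     (pneg ψ)     eq = cong pneg (==P-sound φ ψ eq)
==P-sound (pand φ₁ φ₂) (pand ψ₁ ψ₂) eq =
  let eq₁ , eq₂ = Equivalence.to Bool.T-∧ eq in cong₂ pand (==P-sound φ₁ ψ₁ eq₁) (==P-sound φ₂ ψ₂ eq₂)

==P-refl : ∀ φ → T (φ ==P φ)
==P-refl (pvar a)   = ≡⇒≡ᵇ a a refl
==P-refl ptop       = _
==P-refl (pneg φ)   = ==P-refl φ
==P-refl (pand φ ψ) = Equivalence.from Bool.T-∧ (==P-refl φ , ==P-refl ψ)

_≟ᴾ_ : DecidableEquality PForm
φ ≟ᴾ ψ = map′ (==P-sound φ ψ) (λ { refl → ==P-refl φ }) (T? (φ ==P ψ))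

msize-≡ : ∀ φ → msize φ ≡ length (deduplicate _≟ᴹ_ (msubs φ))
msize-≡ φ = cong length (deduplicateᵇ-≗ _==M_ _≟ᴹ_ ==M-sound ==M-refl (msubs φ))

psize-≡ : ∀ φ → psize φ ≡ length (deduplicate _≟ᴾ_ (psubs φ))
psize-≡ φ = cong length (deduplicateᵇ-≗ _==P_ _≟ᴾ_ ==P-sound ==P-refl (psubs φ))

msize-≤ : ∀ φ {ys} → msubs φ ⊆ ys → msize φ ≤ length ys
msize-≤ φ sub rewrite msize-≡ φ = length-deduplicate-≤ _≟ᴹ_ sub

psize-≤ : ∀ φ {ys} → psubs φ ⊆ ys → psize φ ≤ length ys
psize-≤ φ sub rewrite psize-≡ φ = length-deduplicate-≤ _≟ᴾ_ sub

≤-msize : ∀ φ {us} → Unique us → us ⊆ msubs φ → length us ≤ msize φ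
≤-msize φ !us sub rewrite msize-≡ φ = Unique-⊆⇒≤length-deduplicate _≟ᴹ_ !us sub

≤-psize : ∀ φ {us} → Unique us → us ⊆ psubs φ → length us ≤ psize φ
≤-psize φ !us sub rewrite psize-≡ φ = Unique-⊆⇒≤length-deduplicate _≟ᴾ_ !us sub

pconj : List PForm → PForm
pconj []       = ptop
pconj (φ ∷ φs) = pand φ (pconj φs)

pdisj : List PForm → PForm
pdisj φs = pneg (pconj (map pneg φs))

piff : PForm → PForm → PForm
piff φ ψ = pand (pimp φ ψ) (pimp ψ φ)

psize-pneg : ∀ φ → psize (pneg φ) ≤ suc (psize φ)
psize-pneg φ = begin
  psize (pneg φ)                             ≤⟨ psize-≤ (pneg φ) cover ⟩
  suc (length (deduplicate _≟ᴾ_ (psubs φ))) ≡⟨ cong suc (sym (psize-≡ φ)) ⟩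
  suc (psize φ)                              ∎
  where
  open ≤-Reasoning
  cover : psubs (pneg φ) ⊆ pneg φ ∷ deduplicate _≟ᴾ_ (psubs φ)
  cover (here refl) = here refl
  cover (there χ∈)  = there (∈-deduplicate⁺ _≟ᴾ_ χ∈)

psize-pand : ∀ φ ψ → psize (pand φ ψ) ≤ suc (psize φ + psize ψ)
psize-pand φ ψ = begin
  psize (pand φ ψ)                       ≤⟨ psize-≤ (pand φ ψ) cover ⟩
  suc (length (dd (psubs φ) ++ dd (psubs ψ))) ≡⟨ cong suc (length-++ (dd (psubs φ))) ⟩
  suc (length (dd (psubs φ)) + length (dd (psubs ψ))) ≡⟨ cong suc (sym (cong₂ _+_ (psize-≡ φ) (psize-≡ ψ))) ⟩
  suc (psize φ + psize ψ)                ∎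
  where
  open ≤-Reasoning
  dd = deduplicate _≟ᴾ_
  cover : psubs (pand φ ψ) ⊆ pand φ ψ ∷ (dd (psubs φ) ++ dd (psubs ψ))
  cover (here refl) = here refl
  cover (there χ∈) with ∈-++⁻ (psubs φ) χ∈
  ... | inj₁ χ∈φ = there (∈-++⁺ˡ (∈-deduplicate⁺ _≟ᴾ_ χ∈φ))
  ... | inj₂ χ∈ψ = there (∈-++⁺ʳ (dd (psubs φ)) (∈-deduplicate⁺ _≟ᴾ_ χ∈ψ))

psize-pconj : ∀ φs {b} → All (λ φ → psize φ ≤ b) φs → psize (pconj φs) ≤ suc (length φs * suc b)
psize-pconj []       []         = ≤-refl
psize-pconj (φ ∷ φs) {b} (φ≤ ∷ φs≤) = begin
  psize (pconj (φ ∷ φs))                   ≤⟨ psize-pand φ (pconj φs) ⟩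
  suc (psize φ + psize (pconj φs))         ≤⟨ s≤s (+-mono-≤ φ≤ (psize-pconj φs φs≤)) ⟩
  suc (b + suc (length φs * suc b))        ≡⟨ cong suc (+-suc b _) ⟩
  suc (suc b + length φs * suc b)          ∎
  where open ≤-Reasoning

psize-pdisj : ∀ φs {b} → All (λ φ → psize φ ≤ b) φs → psize (pdisj φs) ≤ suc (suc (length φs * suc (suc b)))
psize-pdisj φs {b} φs≤ = begin
  psize (pdisj φs)                                     ≤⟨ psize-pneg (pconj (map pneg φs)) ⟩
  suc (psize (pconj (map pneg φs)))                    ≤⟨ s≤s (psize-pconj (map pneg φs) ¬φs≤) ⟩
  suc (suc (length (map pneg φs) * suc (suc b)))       ≡⟨ cong (λ l → suc (suc (l * suc (suc b)))) (length-map pneg φs) ⟩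
  suc (suc (length φs * suc (suc b)))                  ∎
  where
  open ≤-Reasoning
  ¬φs≤ : All (λ φ → psize φ ≤ suc b) (map pneg φs)
  ¬φs≤ = All.map⁺ (All.map (λ {φ} φ≤ → ≤-trans (psize-pneg φ) (s≤s φ≤)) φs≤)

psize-pimp : ∀ φ ψ → psize (pimp φ ψ) ≤ 3 + (psize φ + psize ψ)
psize-pimp φ ψ = begin
  psize (pimp φ ψ)                    ≤⟨ psize-pneg (pand φ (pneg ψ)) ⟩
  suc (psize (pand φ (pneg ψ)))       ≤⟨ s≤s (psize-pand φ (pneg ψ)) ⟩
  2 + (psize φ + psize (pneg ψ))      ≤⟨ s≤s (s≤s (+-mono-≤ ≤-refl (psize-pneg ψ))) ⟩
  2 + (psize φ + suc (psize ψ))       ≡⟨ cong (2 +_) (+-suc (psize φ) (psize ψ)) ⟩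
  3 + (psize φ + psize ψ)             ∎
  where open ≤-Reasoning

psize-piff : ∀ φ ψ → psize (piff φ ψ) ≤ suc (2 * (3 + (psize φ + psize ψ)))
psize-piff φ ψ = begin
  psize (piff φ ψ)                          ≤⟨ psize-pand (pimp φ ψ) (pimp ψ φ) ⟩
  suc (psize (pimp φ ψ) + psize (pimp ψ φ)) ≤⟨ s≤s (+-mono-≤ (psize-pimp φ ψ) ψφ≤) ⟩
  suc (c + c)                               ≡⟨ cong (λ m → suc (c + m)) (sym (+-identityʳ c)) ⟩
  suc (2 * c)                               ∎
  where
  open ≤-Reasoning
  c = 3 + (psize φ + psize ψ)
  ψφ≤ : psize (pimp ψ φ) ≤ c
  ψφ≤ = ≤-trans (psize-pimp ψ φ) (≤-reflexive (cong (3 +_) (+-comm (psize ψ) (psize φ))))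

pconj-suffixes : List PForm → List PForm
pconj-suffixes []       = ptop ∷ []
pconj-suffixes (φ ∷ φs) = pconj (φ ∷ φs) ∷ pconj-suffixes φs

length-pconj-suffixes : ∀ φs → length (pconj-suffixes φs) ≡ suc (length φs)
length-pconj-suffixes []       = refl
length-pconj-suffixes (φ ∷ φs) = cong suc (length-pconj-suffixes φs)

psubs-pconj : ∀ φs {χ} → χ ∈ psubs (pconj φs) → χ ∈ pconj-suffixes φs ⊎ ∃[ φ ] (φ ∈ φs × χ ∈ psubs φ)
psubs-pconj []       (here refl) = inj₁ (here refl)
psubs-pconj (φ ∷ φs) (here refl) = inj₁ (here refl)
psubs-pconj (φ ∷ φs) (there χ∈) with ∈-++⁻ (psubs φ) χ∈
... | inj₁ χ∈φ = inj₂ (φ , here refl , χ∈φ)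
... | inj₂ χ∈φs with psubs-pconj φs χ∈φs
...   | inj₁ suffix          = inj₁ (there suffix)
...   | inj₂ (ψ , ψ∈ , χ∈ψ) = inj₂ (ψ , there ψ∈ , χ∈ψ)

psig-pconj : ∀ φs {c} → c ∈ psig (pconj φs) → ∃[ φ ] (φ ∈ φs × c ∈ psig φ)
psig-pconj (φ ∷ φs) c∈ with ∈-++⁻ (psig φ) c∈
... | inj₁ c∈φ  = φ , here refl , c∈φ
... | inj₂ c∈φs = let ψ , ψ∈ , c∈ψ = psig-pconj φs c∈φs in ψ , there ψ∈ , c∈ψ

psig-piff : ∀ φ ψ {c} → c ∈ psig (piff φ ψ) → c ∈ psig φ ⊎ c ∈ psig ψ
psig-piff φ ψ c∈ with ∈-++⁻ (psig φ ++ psig ψ) c∈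
... | inj₁ c∈φψ = ∈-++⁻ (psig φ) c∈φψ
... | inj₂ c∈ψφ with ∈-++⁻ (psig ψ) c∈ψφ
...   | inj₁ c∈ψ = inj₂ c∈ψ
...   | inj₂ c∈φ = inj₁ c∈φ

length-psubs-pandˡ : ∀ φ ψ → length (psubs φ) < length (psubs (pand φ ψ))
length-psubs-pandˡ φ ψ = s≤s (≤-trans (m≤m+n _ _) (≤-reflexive (sym (length-++ (psubs φ)))))

length-psubs-pandʳ : ∀ φ ψ → length (psubs ψ) < length (psubs (pand φ ψ))
length-psubs-pandʳ φ ψ = s≤s (≤-trans (m≤n+m _ _) (≤-reflexive (sym (length-++ (psubs φ)))))

psubs-length-mono : ∀ φ {χ} → χ ∈ psubs φ → length (psubs χ) ≤ length (psubs φ)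
psubs-length-mono (pvar a)   (here refl) = ≤-refl
psubs-length-mono ptop       (here refl) = ≤-refl
psubs-length-mono (pneg φ)   (here refl) = ≤-refl
psubs-length-mono (pneg φ)   (there χ∈)  = m≤n⇒m≤1+n (psubs-length-mono φ χ∈)
psubs-length-mono (pand φ ψ) (here refl) = ≤-refl
psubs-length-mono (pand φ ψ) (there χ∈) with ∈-++⁻ (psubs φ) χ∈
... | inj₁ χ∈φ = ≤-trans (psubs-length-mono φ χ∈φ) (<⇒≤ (length-psubs-pandˡ φ ψ))
... | inj₂ χ∈ψ = ≤-trans (psubs-length-mono ψ χ∈ψ) (<⇒≤ (length-psubs-pandʳ φ ψ))

psubs-longer-∉ : ∀ {φ χ} → length (psubs φ) < length (psubs χ) → χ ∉ psubs φ
psubs-longer-∉ {φ} longer χ∈ = <⇒≱ longer (psubs-length-mono φ χ∈)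

psig-psubs : ∀ φ {χ} → χ ∈ psubs φ → psig χ ⊆ psig φ
psig-psubs (pvar a)   (here refl) = id
psig-psubs ptop       (here refl) = id
psig-psubs (pneg φ)   (here refl) = id
psig-psubs (pneg φ)   (there χ∈)  = psig-psubs φ χ∈
psig-psubs (pand φ ψ) (here refl) = id
psig-psubs (pand φ ψ) (there χ∈) with ∈-++⁻ (psubs φ) χ∈
... | inj₁ χ∈φ = ∈-++⁺ˡ ∘ psig-psubs φ χ∈φ
... | inj₂ χ∈ψ = ∈-++⁺ʳ (psig φ) ∘ psig-psubs ψ χ∈ψ

pvar-∈-psubs : ∀ φ {a} → a ∈ psig φ → pvar a ∈ psubs φ
pvar-∈-psubs (pvar a)   (here refl) = here refl
pvar-∈-psubs (pneg φ)   a∈ = there (pvar-∈-psubs φ a∈)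
pvar-∈-psubs (pand φ ψ) a∈ with ∈-++⁻ (psig φ) a∈
... | inj₁ a∈φ = there (∈-++⁺ˡ (pvar-∈-psubs φ a∈φ))
... | inj₂ a∈ψ = there (∈-++⁺ʳ (psubs φ) (pvar-∈-psubs ψ a∈ψ))

peval-cong : ∀ {v v′ : Atom → Bool} φ → (∀ {c} → c ∈ psig φ → v c ≡ v′ c) → peval v φ ≡ peval v′ φ
peval-cong (pvar a)   v≡v′ = v≡v′ (here refl)
peval-cong ptop       v≡v′ = refl
peval-cong (pneg φ)   v≡v′ = cong not (peval-cong φ v≡v′)
peval-cong (pand φ ψ) v≡v′ =
  cong₂ _∧_ (peval-cong φ (v≡v′ ∘ ∈-++⁺ˡ)) (peval-cong ψ (v≡v′ ∘ ∈-++⁺ʳ (psig φ)))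

psize-Unique : ∀ φ → Unique (psubs φ) → psize φ ≡ length (psubs φ)
psize-Unique φ !φ = ≤-antisym (psize-≤ φ id) (≤-psize φ !φ id)

var-∈-msubs : ∀ φ {a} → a ∈ msig φ → var a ∈ msubs φ
var-∈-msubs (var a)   (here refl) = here refl
var-∈-msubs (neg φ)   a∈ = there (var-∈-msubs φ a∈)
var-∈-msubs (box φ)   a∈ = there (var-∈-msubs φ a∈)
var-∈-msubs (and φ ψ) a∈ with ∈-++⁻ (msig φ) a∈
... | inj₁ a∈φ = there (∈-++⁺ˡ (var-∈-msubs φ a∈φ))
... | inj₂ a∈ψ = there (∈-++⁺ʳ (msubs φ) (var-∈-msubs ψ a∈ψ))

-- Propositional and Kripke semantics

∧-true⁻ : ∀ {x y} → x ∧ y ≡ true → x ≡ true × y ≡ true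
∧-true⁻ {true} y✓ = refl , y✓

implication-intro : ∀ {x y} → (x ≡ true → y ≡ true) → not (x ∧ not y) ≡ true
implication-intro {false}         _   = refl
implication-intro {true} {true}   _   = refl
implication-intro {true} {false}  x⇒y = x⇒y refl

implication-elim : ∀ {x y} → not (x ∧ not y) ≡ true → x ≡ true → y ≡ true
implication-elim {true} {true} _ _ = refl

biconditional-intro : ∀ {x y} → x ≡ y → (not (x ∧ not y) ∧ not (y ∧ not x)) ≡ true
biconditional-intro {false} refl = refl
biconditional-intro {true}  refl = refl

biconditional-elim : ∀ {x y} → (not (x ∧ not y) ∧ not (y ∧ not x)) ≡ true → x ≡ y
biconditional-elim {false} {false} _ = refl
biconditional-elim {true}  {true}  _ = refl

module _ {A : Set} (p : A → Bool) where

  allB-true⁺ : ∀ xs → All (λ x → p x ≡ true) xs → allB p xs ≡ true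
  allB-true⁺ []       []           = refl
  allB-true⁺ (x ∷ xs) (px ∷ pxs)   = cong₂ _∧_ px (allB-true⁺ xs pxs)

  allB-true⁻ : ∀ xs → allB p xs ≡ true → All (λ x → p x ≡ true) xs
  allB-true⁻ []       _   = []
  allB-true⁻ (x ∷ xs) all = let px , pxs = ∧-true⁻ all in px ∷ allB-true⁻ xs pxs

  allB-false⁻ : ∀ xs → allB p xs ≡ false → Any (λ x → p x ≡ false) xs
  allB-false⁻ (x ∷ xs) all with p x in px
  ... | false = here px
  ... | true  = there (allB-false⁻ xs all)

module _ (v : Atom → Bool) where

  pconj-true⁺ : ∀ φs → All (λ φ → peval v φ ≡ true) φs → peval v (pconj φs) ≡ true
  pconj-true⁺ []       []         = refl
  pconj-true⁺ (φ ∷ φs) (φ✓ ∷ φs✓) = cong₂ _∧_ φ✓ (pconj-true⁺ φs φs✓)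

  pconj-true⁻ : ∀ φs → peval v (pconj φs) ≡ true → All (λ φ → peval v φ ≡ true) φs
  pconj-true⁻ []       _  = []
  pconj-true⁻ (φ ∷ φs) ✓ = let φ✓ , φs✓ = ∧-true⁻ ✓ in φ✓ ∷ pconj-true⁻ φs φs✓

  pdisj-true⁺ : ∀ {φs} → Any (λ φ → peval v φ ≡ true) φs → peval v (pdisj φs) ≡ true
  pdisj-true⁺ = cong not ∘ negations-false
    where
    negations-false : ∀ {φs} → Any (λ φ → peval v φ ≡ true) φs → peval v (pconj (map pneg φs)) ≡ false
    negations-false (here φ✓) rewrite φ✓ = refl
    negations-false {φ ∷ _} (there φs✓) rewrite negations-false φs✓ = Bool.∧-zeroʳ (not (peval v φ))

  pdisj-true⁻ : ∀ φs → peval v (pdisj φs) ≡ true → Any (λ φ → peval v φ ≡ true) φs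
  pdisj-true⁻ (φ ∷ φs) ✓ with peval v φ in φ✓
  ... | true  = here φ✓
  ... | false = there (pdisj-true⁻ φs ✓)

≡true-antisym : ∀ {x y} → (x ≡ true → y ≡ true) → (y ≡ true → x ≡ true) → x ≡ y
≡true-antisym {false} {false} _   _   = refl
≡true-antisym {false} {true}  _   y⇒x = y⇒x refl
≡true-antisym {true}          x⇒y _   = sym (x⇒y refl)

dia : MForm → MForm
dia φ = neg (box (neg φ))

Literal : Set
Literal = MForm × Bool

lit : Literal → MForm
lit (φ , true)  = φ
lit (φ , false) = neg φ

conj : List Literal → MForm
conj []       = top
conj (l ∷ ls) = and (lit l) (conj ls)

module _ (F : PFrame) (V : Atom → Fin (n F) → Bool) where

  box-true⁺ : ∀ {w} φ → (∀ u → R F w u ≡ true → meval F V u φ ≡ true) → meval F V w (box φ) ≡ true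
  box-true⁺ {w} φ φ✓ = allB-true⁺ _ (allFin (n F)) (All.tabulate (λ {u} _ → at u))
    where
    at : ∀ u → (if R F w u then meval F V u φ else true) ≡ true
    at u with R F w u in w⇝u
    ... | true  = φ✓ u w⇝u
    ... | false = refl

  box-true⁻ : ∀ {w u} φ → meval F V w (box φ) ≡ true → R F w u ≡ true → meval F V u φ ≡ true
  box-true⁻ {w} {u} φ □φ✓ w⇝u with All.lookup (allB-true⁻ _ (allFin (n F)) □φ✓) (∈-allFin u)
  ... | φ✓ rewrite w⇝u = φ✓

  dia-true⁺ : ∀ {w u} φ → R F w u ≡ true → meval F V u φ ≡ true → meval F V w (dia φ) ≡ true
  dia-true⁺ {w} {u} φ w⇝u φ✓ with meval F V w (box (neg φ)) in □¬φ✓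
  ... | false = refl
  ... | true  = trans (sym (cong not φ✓)) (box-true⁻ (neg φ) □¬φ✓ w⇝u)

  dia-true⁻ : ∀ {w} φ → meval F V w (dia φ) ≡ true → ∃[ u ] (R F w u ≡ true × meval F V u φ ≡ true)
  dia-true⁻ {w} φ ◇φ✓ =
    let u , _ , u✗ = find (allB-false⁻ _ (allFin (n F)) (not-true⁻ ◇φ✓)) in u , witness u u✗
    where
    not-true⁻ : ∀ {x} → not x ≡ true → x ≡ false
    not-true⁻ {false} _ = refl
    witness : ∀ u → (if R F w u then not (meval F V u φ) else true) ≡ false → R F w u ≡ true × meval F V u φ ≡ true
    witness u u✗ with R F w u | meval F V u φ
    ... | true | true = refl , refl

record Model : Set where
  field
    frame     : PFrame
    valuation : Atom → Fin (n frame) → Bool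
open Model public

World : Model → Set
World M = Fin (n (frame M))

eval : (M : Model) → World M → MForm → Bool
eval M = meval (frame M) (valuation M)

_∋_⇝_ : (M : Model) → World M → World M → Set
M ∋ w ⇝ u = R (frame M) w u ≡ true

module _ (M : Model) where

  successors : World M → List (World M)
  successors u = filter (λ x → R (frame M) u x Bool.≟ true) (allFin (n (frame M)))

  length-successors : ∀ u → length (successors u) ≤ n (frame M)
  length-successors u =
    ≤-trans (length-filter (λ x → R (frame M) u x Bool.≟ true) (allFin _)) (≤-reflexive (length-allFin (n (frame M))))

  ∈-successors⁺ : ∀ {u x} → M ∋ u ⇝ x → x ∈ successors u
  ∈-successors⁺ {u} {x} = ∈-filter⁺ (λ x → R (frame M) u x Bool.≟ true) (∈-allFin x)

  ∈-successors⁻ : ∀ {u x} → x ∈ successors u → M ∋ u ⇝ x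
  ∈-successors⁻ {u} x∈ = proj₂ (∈-filter⁻ (λ x → R (frame M) u x Bool.≟ true) {xs = allFin _} x∈)

eval-lit-cong : ∀ {M u M′ u′ φ} b → eval M u φ ≡ eval M′ u′ φ →
  eval M u (lit (φ , b)) ≡ eval M′ u′ (lit (φ , b))
eval-lit-cong true  φ≡ = φ≡
eval-lit-cong false φ≡ = cong not φ≡

eval-conj-cong : ∀ {M u M′ u′} ls → All (λ l → eval M u (proj₁ l) ≡ eval M′ u′ (proj₁ l)) ls →
  eval M u (conj ls) ≡ eval M′ u′ (conj ls)
eval-conj-cong []             []         = refl
eval-conj-cong ((φ , b) ∷ ls) (φ≡ ∷ ls≡) = cong₂ _∧_ (eval-lit-cong b φ≡) (eval-conj-cong ls ls≡)

lit-holds : ∀ {M v} φ → eval M v (lit (φ , eval M v φ)) ≡ true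
lit-holds {M} {v} φ with eval M v φ in φ✓
... | true  = φ✓
... | false = cong not φ✓

lit-fails : ∀ {M x} φ b → b ≢ eval M x φ → eval M x (lit (φ , b)) ≡ false
lit-fails {M} {x} φ b b≢ with eval M x φ in φ✓
lit-fails φ true  b≢ | true  = ⊥-elim (b≢ refl)
lit-fails φ true  b≢ | false = φ✓
lit-fails φ false b≢ | true  = cong not φ✓
lit-fails φ false b≢ | false = ⊥-elim (b≢ refl)

msig-conj : ∀ ls {a} → a ∈ msig (conj ls) → ∃[ l ] (l ∈ ls × a ∈ msig (proj₁ l))
msig-conj ((φ , true)  ∷ ls) a∈ with ∈-++⁻ (msig φ) a∈
... | inj₁ a∈φ  = (φ , true) , here refl , a∈φ
... | inj₂ a∈ls = let l , l∈ , a∈l = msig-conj ls a∈ls in l , there l∈ , a∈l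
msig-conj ((φ , false) ∷ ls) a∈ with ∈-++⁻ (msig φ) a∈
... | inj₁ a∈φ  = (φ , false) , here refl , a∈φ
... | inj₂ a∈ls = let l , l∈ , a∈l = msig-conj ls a∈ls in l , there l∈ , a∈l

length-msubs-conj : ∀ ls {B} → All (λ l → length (msubs (proj₁ l)) ≤ B) ls →
  length (msubs (conj ls)) ≤ suc (length ls * (2 + B))
length-msubs-conj []             []         = ≤-refl
length-msubs-conj ((φ , b) ∷ ls) {B} (φ≤ ∷ ls≤) = s≤s (begin
  length (msubs (lit (φ , b)) ++ msubs (conj ls))           ≡⟨ length-++ (msubs (lit (φ , b))) ⟩
  length (msubs (lit (φ , b))) + length (msubs (conj ls))   ≤⟨ +-mono-≤ (lit≤ b) (length-msubs-conj ls ls≤) ⟩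
  suc B + suc (length ls * (2 + B))                         ≡⟨ cong suc (+-suc B _) ⟩
  (2 + B) + length ls * (2 + B)                             ∎)
  where
  open ≤-Reasoning
  lit≤ : ∀ b → length (msubs (lit (φ , b))) ≤ suc B
  lit≤ true  = m≤n⇒m≤1+n φ≤
  lit≤ false = s≤s φ≤

-- Polynomials

infixl 6 _+ₚ_
infixl 7 _·ₚ_ _*ₚ_
infixr 8 _^ₚ_

_+ₚ_ : Poly → Poly → Poly
[]      +ₚ q       = q
(a ∷ p) +ₚ []      = a ∷ p
(a ∷ p) +ₚ (b ∷ q) = a + b ∷ p +ₚ q

_·ₚ_ : ℕ → Poly → Poly
c ·ₚ p = map (c *_) p

_*ₚ_ : Poly → Poly → Poly
[]      *ₚ q = []
(a ∷ p) *ₚ q = a ·ₚ q +ₚ (0 ∷ p *ₚ q)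

_^ₚ_ : Poly → ℕ → Poly
p ^ₚ zero  = 1 ∷ []
p ^ₚ suc e = p *ₚ p ^ₚ e

constₚ : ℕ → Poly
constₚ c = c ∷ []

Xₚ : Poly
Xₚ = 0 ∷ 1 ∷ []

module _ (x : ℕ) where
  open +-*-Solver

  evalPoly-+ₚ : ∀ p q → evalPoly (p +ₚ q) x ≡ evalPoly p x + evalPoly q x
  evalPoly-+ₚ []      q       = refl
  evalPoly-+ₚ (a ∷ p) []      = sym (+-identityʳ _)
  evalPoly-+ₚ (a ∷ p) (b ∷ q) rewrite evalPoly-+ₚ p q =
    solve 5 (λ a b x p q → (a :+ b) :+ x :* (p :+ q) := (a :+ x :* p) :+ (b :+ x :* q)) refl
      a b x (evalPoly p x) (evalPoly q x)

  evalPoly-·ₚ : ∀ c p → evalPoly (c ·ₚ p) x ≡ c * evalPoly p x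
  evalPoly-·ₚ c []      = sym (*-zeroʳ c)
  evalPoly-·ₚ c (a ∷ p) rewrite evalPoly-·ₚ c p =
    solve 4 (λ c a x p → c :* a :+ x :* (c :* p) := c :* (a :+ x :* p)) refl c a x (evalPoly p x)

  evalPoly-*ₚ : ∀ p q → evalPoly (p *ₚ q) x ≡ evalPoly p x * evalPoly q x
  evalPoly-*ₚ []      q = refl
  evalPoly-*ₚ (a ∷ p) q rewrite evalPoly-+ₚ (a ·ₚ q) (0 ∷ p *ₚ q) | evalPoly-·ₚ a q | evalPoly-*ₚ p q =
    solve 4 (λ a q x p → a :* q :+ (con 0 :+ x :* (p :* q)) := (a :+ x :* p) :* q) refl a (evalPoly q x) x (evalPoly p x)

  evalPoly-constₚ : ∀ c → evalPoly (constₚ c) x ≡ c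
  evalPoly-constₚ c = trans (cong (c +_) (*-zeroʳ x)) (+-identityʳ c)

  evalPoly-^ₚ : ∀ p e → evalPoly (p ^ₚ e) x ≡ evalPoly p x ^ e
  evalPoly-^ₚ p zero    = evalPoly-constₚ 1
  evalPoly-^ₚ p (suc e) = trans (evalPoly-*ₚ p (p ^ₚ e)) (cong (evalPoly p x *_) (evalPoly-^ₚ p e))

  evalPoly-Xₚ : evalPoly Xₚ x ≡ x
  evalPoly-Xₚ = trans (cong (x *_) (evalPoly-constₚ 1)) (*-identityʳ x)

evalPoly-mono : ∀ p {x y} → x ≤ y → evalPoly p x ≤ evalPoly p y
evalPoly-mono []      x≤y = z≤n
evalPoly-mono (a ∷ p) x≤y = +-monoʳ-≤ a (*-mono-≤ x≤y (evalPoly-mono p x≤y))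

-- Characteristic formulas

module _ {A : Set} where

  listsUpTo : ℕ → List A → List (List A)
  listsUpTo zero    xs = [] ∷ []
  listsUpTo (suc k) xs = [] ∷ cartesianProductWith _∷_ xs (listsUpTo k xs)

  ∈-listsUpTo⁺ : ∀ {k xs ys} → length ys ≤ k → ys ⊆ xs → ys ∈ listsUpTo k xs
  ∈-listsUpTo⁺ {zero}  {ys = []}     _         _     = here refl
  ∈-listsUpTo⁺ {suc k} {ys = []}     _         _     = here refl
  ∈-listsUpTo⁺ {suc k} {ys = y ∷ ys} (s≤s len) ys⊆xs =
    there (∈-cartesianProductWith⁺ _∷_ (ys⊆xs (here refl)) (∈-listsUpTo⁺ len (ys⊆xs ∘ there)))

  ∈-listsUpTo⁻ : ∀ k xs {ys} → ys ∈ listsUpTo k xs → length ys ≤ k × ys ⊆ xs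
  ∈-listsUpTo⁻ zero    xs (here refl) = z≤n , λ ()
  ∈-listsUpTo⁻ (suc k) xs (here refl) = z≤n , λ ()
  ∈-listsUpTo⁻ (suc k) xs (there ys∈)
    with y , ys , y∈xs , ys∈′ , refl ← ∈-cartesianProductWith⁻ _∷_ xs (listsUpTo k xs) ys∈ =
    let len , ys⊆xs = ∈-listsUpTo⁻ k xs ys∈′
    in s≤s len , λ { (here refl) → y∈xs ; (there z∈ys) → ys⊆xs z∈ys }

  length-listsUpTo : ∀ k xs → length (listsUpTo k xs) ≤ suc (length xs) ^ k
  length-listsUpTo zero    xs = ≤-refl
  length-listsUpTo (suc k) xs = begin
    suc (length (cartesianProductWith _∷_ xs (listsUpTo k xs)))
      ≡⟨ cong suc (length-cartesianProductWith _∷_ xs (listsUpTo k xs)) ⟩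
    suc (length xs * length (listsUpTo k xs))
      ≤⟨ s≤s (*-monoʳ-≤ (length xs) (length-listsUpTo k xs)) ⟩
    suc (length xs * suc (length xs) ^ k)
      ≤⟨ +-monoˡ-≤ _ (m^n>0 (suc (length xs)) k) ⟩
    suc (length xs) ^ suc k
      ∎
    where open ≤-Reasoning

literals : List MForm → List Literal
literals φs = cartesianProduct φs (true ∷ false ∷ [])

∈-literals⁺ : ∀ {φ φs} b → φ ∈ φs → (φ , b) ∈ literals φs
∈-literals⁺ true  φ∈ = ∈-cartesianProduct⁺ φ∈ (here refl)
∈-literals⁺ false φ∈ = ∈-cartesianProduct⁺ φ∈ (there (here refl))

∈-literals⁻ : ∀ {l} φs → l ∈ literals φs → proj₁ l ∈ φs
∈-literals⁻ φs l∈ = proj₁ (∈-cartesianProduct⁻ φs _ l∈)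

length-literals : ∀ φs → length (literals φs) ≡ length φs * 2
length-literals φs = length-cartesianProductWith _,_ φs (true ∷ false ∷ [])

ΨtreeSize : ℕ → ℕ → ℕ
ΨtreeSize N zero    = 1
ΨtreeSize N (suc i) = ΨtreeSize N i + (4 + N * (2 + ΨtreeSize N i))

Ψlengthₚ : ℕ → ℕ → Poly
Ψlengthₚ N zero    = Xₚ
Ψlengthₚ N (suc i) = Ψlengthₚ N i +ₚ (constₚ 1 +ₚ 2 ·ₚ Ψlengthₚ N i) ^ₚ N

module CharacteristicFormulas (N : ℕ) (σ : List Atom) where

  Ψ : ℕ → List MForm
  Ψ zero    = map var σ
  Ψ (suc i) = Ψ i ++ map (dia ∘ conj) (listsUpTo N (literals (Ψ i)))

  ∈-Ψ-zero⇒∈-Ψ : ∀ i {φ} → φ ∈ Ψ 0 → φ ∈ Ψ i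
  ∈-Ψ-zero⇒∈-Ψ zero    φ∈ = φ∈
  ∈-Ψ-zero⇒∈-Ψ (suc i) φ∈ = ∈-++⁺ˡ (∈-Ψ-zero⇒∈-Ψ i φ∈)

  record Agree (i : ℕ) (M : Model) (u : World M) (M′ : Model) (u′ : World M′) : Set where
    constructor agree
    field agreement : All (λ φ → eval M u φ ≡ eval M′ u′ φ) (Ψ i)
  open Agree

  agree? : ∀ i M u M′ u′ → Dec (Agree i M u M′ u′)
  agree? i M u M′ u′ = map′ agree agreement (All.all? (λ φ → eval M u φ Bool.≟ eval M′ u′ φ) (Ψ i))

  Agree-sym : ∀ {i M u M′ u′} → Agree i M u M′ u′ → Agree i M′ u′ M u
  Agree-sym (agree u≈u′) = agree (All.map sym u≈u′)

  Agree-suc⇒Agree : ∀ {i M u M′ u′} → Agree (suc i) M u M′ u′ → Agree i M u M′ u′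
  Agree-suc⇒Agree {i} (agree u≈u′) = agree (All.++⁻ˡ (Ψ i) u≈u′)

  separating-literals : ∀ {i M M′} v (xs : List (World M′)) → All (λ x → ¬ Agree i M v M′ x) xs →
    ∃[ ls ] (length ls ≤ length xs × ls ⊆ literals (Ψ i)
             × eval M v (conj ls) ≡ true × All (λ x → eval M′ x (conj ls) ≡ false) xs)
  separating-literals v []       []          = [] , z≤n , (λ ()) , refl , []
  separating-literals {i} {M} {M′} v (x ∷ xs) (v≉x ∷ v≉xs)
    with φ , φ∈ , φ≢ ← find (¬All⇒Any¬ (λ φ → eval M v φ Bool.≟ eval M′ x φ) (Ψ i) (v≉x ∘ agree))
       | ls , len , ls⊆ , v✓ , xs✗ ← separating-literals v xs v≉xs
    = (φ , eval M v φ) ∷ ls , s≤s len , ∈-∷⁺ʳ (∈-literals⁺ _ φ∈) ls⊆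
    , cong₂ _∧_ (lit-holds φ) v✓
    , cong (_∧ eval M′ x (conj ls)) (lit-fails φ _ φ≢)
      ∷ All.map (λ {y} y✗ → trans (cong (eval M′ y (lit (φ , eval M v φ)) ∧_) y✗) (Bool.∧-zeroʳ _)) xs✗

  dia-conj-∈Ψ : ∀ {i ls} → length ls ≤ N → ls ⊆ literals (Ψ i) → dia (conj ls) ∈ Ψ (suc i)
  dia-conj-∈Ψ {i} len ls⊆ = ∈-++⁺ʳ (Ψ i) (∈-map⁺ (dia ∘ conj) (∈-listsUpTo⁺ len ls⊆))

  separated⇒disagree : ∀ {i M M′ u u′ v} → n (frame M′) ≤ N → M ∋ u ⇝ v →
    All (λ x → ¬ Agree i M v M′ x) (successors M′ u′) → ¬ Agree (suc i) M u M′ u′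
  separated⇒disagree {i} {M} {M′} {u} {u′} M′≤N u⇝v v≉ u≈u′
    with ls , len , ls⊆ , v✓ , successors✗ ← separating-literals _ (successors M′ u′) v≉
    with x , u′⇝x , x✓ ← dia-true⁻ (frame M′) (valuation M′) (conj ls)
           (trans (sym (All.lookup (agreement u≈u′)
                                   (dia-conj-∈Ψ {i} (≤-trans len (≤-trans (length-successors M′ u′) M′≤N)) ls⊆)))
                  (dia-true⁺ (frame M) (valuation M) (conj ls) u⇝v v✓))
    with () ← trans (sym x✓) (All.lookup successors✗ (∈-successors⁺ M′ u′⇝x))

  forth : ∀ {i M M′ u u′ v} → n (frame M′) ≤ N → Agree (suc i) M u M′ u′ → M ∋ u ⇝ v →
    ∃[ v′ ] (M′ ∋ u′ ⇝ v′ × Agree i M v M′ v′)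
  forth {i} {M} {M′} {u} {u′} {v} M′≤N u≈u′ u⇝v
    with any? (λ v′ → (R (frame M′) u′ v′ Bool.≟ true) ×-dec agree? i M v M′ v′) (allFin (n (frame M′)))
  ... | yes ∃v′ = let v′ , _ , u′⇝v′ , v≈v′ = find ∃v′ in v′ , u′⇝v′ , v≈v′
  ... | no ∄v′ = ⊥-elim (separated⇒disagree M′≤N u⇝v v≉successors u≈u′)
    where
    v≉successors : All (λ x → ¬ Agree i M v M′ x) (successors M′ u′)
    v≉successors = All.tabulate λ {x} x∈ v≈x → ∄v′ (lose (∈-allFin x) (∈-successors⁻ M′ x∈ , v≈x))

  back : ∀ {i M M′ u u′ v′} → n (frame M) ≤ N → Agree (suc i) M u M′ u′ → M′ ∋ u′ ⇝ v′ →
    ∃[ v ] (M ∋ u ⇝ v × Agree i M v M′ v′)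
  back {i} M≤N u≈u′ u′⇝v′ =
    let v , u⇝v , v′≈v = forth M≤N (Agree-sym u≈u′) u′⇝v′ in v , u⇝v , Agree-sym v′≈v

  Stable : ℕ → Model → Model → Set
  Stable i M M′ = ∀ {u u′} → Agree i M u M′ u′ → Agree (suc i) M u M′ u′

  Stable-sym : ∀ {i M M′} → Stable i M M′ → Stable i M′ M
  Stable-sym stable = Agree-sym ∘ stable ∘ Agree-sym

  dia-conj-transfer : ∀ {i M M′ u u′} ls → n (frame M′) ≤ N → Stable i M M′ → Agree (suc i) M u M′ u′ →
    ls ⊆ literals (Ψ (suc i)) → eval M u (dia (conj ls)) ≡ true → eval M′ u′ (dia (conj ls)) ≡ true
  dia-conj-transfer {i} {M} {M′} ls M′≤N stable u≈u′ ls⊆ ◇γ✓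
    with v , u⇝v , γ✓ ← dia-true⁻ (frame M) (valuation M) (conj ls) ◇γ✓
    with v′ , u′⇝v′ , v≈v′ ← forth M′≤N u≈u′ u⇝v
    = dia-true⁺ (frame M′) (valuation M′) (conj ls) u′⇝v′ (trans (sym γ≡) γ✓)
    where
    γ≡ = eval-conj-cong ls (All.tabulate λ l∈ →
           All.lookup (agreement (stable v≈v′)) (∈-literals⁻ (Ψ (suc i)) (ls⊆ l∈)))

  Stable-suc : ∀ {i M M′} → n (frame M) ≤ N → n (frame M′) ≤ N → Stable i M M′ → Stable (suc i) M M′
  Stable-suc {i} {M} {M′} M≤N M′≤N stable {u} {u′} (agree u≈u′) =
    agree (All.++⁺ u≈u′ (All.map⁺ (All.tabulate λ {ls} ls∈ →
      let ls⊆ = proj₂ (∈-listsUpTo⁻ N _ ls∈) in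
      ≡true-antisym (dia-conj-transfer ls M′≤N stable (agree u≈u′) ls⊆)
                    (dia-conj-transfer ls M≤N (Stable-sym stable) (Agree-sym (agree u≈u′)) ls⊆))))

  Stable-+ : ∀ {i M M′} d → n (frame M) ≤ N → n (frame M′) ≤ N → Stable i M M′ → Stable (d + i) M M′
  Stable-+ zero    M≤N M′≤N stable = stable
  Stable-+ (suc d) M≤N M′≤N stable = Stable-suc M≤N M′≤N (Stable-+ d M≤N M′≤N stable)

  Stable-N² : ∀ {M M′} → n (frame M) ≤ N → n (frame M′) ≤ N → Stable (N * N) M M′
  Stable-N² {M} {M′} M≤N M′≤N =
    let j , j≤ , stableⱼ = descending-chain-stabilises (λ i (u , u′) → Agree i M u M′ u′)
                              (λ i (u , u′) → agree? i M u M′ u′) (λ i → Agree-suc⇒Agree) pairs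
    in subst (λ m → Stable m M M′) (m∸n+n≡m (≤-trans j≤ pairs≤N²))
         (Stable-+ (N * N ∸ j) M≤N M′≤N (stableⱼ (∈-cartesianProduct⁺ (∈-allFin _) (∈-allFin _))))
    where
    open ≤-Reasoning
    pairs = cartesianProduct (allFin (n (frame M))) (allFin (n (frame M′)))
    pairs≤N² : length pairs ≤ N * N
    pairs≤N² = begin
      length pairs
        ≡⟨ length-cartesianProductWith _,_ (allFin (n (frame M))) (allFin (n (frame M′))) ⟩
      length (allFin (n (frame M))) * length (allFin (n (frame M′)))
        ≡⟨ cong₂ _*_ (length-allFin (n (frame M))) (length-allFin (n (frame M′))) ⟩
      n (frame M) * n (frame M′)
        ≤⟨ *-mono-≤ M≤N M′≤N ⟩
      N * N
        ∎

  module _ {i M M′} (M≤N : n (frame M) ≤ N) (M′≤N : n (frame M′) ≤ N) (stable : Stable i M M′) where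

    Agree⇒σ-equivalent : ∀ φ → msig φ ⊆ σ → ∀ {u u′} → Agree i M u M′ u′ → eval M u φ ≡ eval M′ u′ φ
    Agree⇒σ-equivalent (var a)   a∈σ  (agree u≈u′) = All.lookup u≈u′ (∈-Ψ-zero⇒∈-Ψ i (∈-map⁺ var (a∈σ (here refl))))
    Agree⇒σ-equivalent top       _    _            = refl
    Agree⇒σ-equivalent (neg φ)   φ⊆σ  u≈u′         = cong not (Agree⇒σ-equivalent φ φ⊆σ u≈u′)
    Agree⇒σ-equivalent (and φ ψ) φψ⊆σ u≈u′         =
      cong₂ _∧_ (Agree⇒σ-equivalent φ (φψ⊆σ ∘ ∈-++⁺ˡ) u≈u′)
              (Agree⇒σ-equivalent ψ (φψ⊆σ ∘ ∈-++⁺ʳ (msig φ)) u≈u′)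
    Agree⇒σ-equivalent (box φ)   φ⊆σ  u≈u′         = ≡true-antisym
      (λ □φ✓ → box-true⁺ (frame M′) (valuation M′) φ λ v′ u′⇝v′ →
        let v , u⇝v , v≈v′ = back M≤N (stable u≈u′) u′⇝v′
        in trans (sym (Agree⇒σ-equivalent φ φ⊆σ v≈v′)) (box-true⁻ (frame M) (valuation M) φ □φ✓ u⇝v))
      (λ □φ✓ → box-true⁺ (frame M) (valuation M) φ λ v u⇝v →
        let v′ , u′⇝v′ , v≈v′ = forth M′≤N (stable u≈u′) u⇝v
        in trans (Agree⇒σ-equivalent φ φ⊆σ v≈v′) (box-true⁻ (frame M′) (valuation M′) φ □φ✓ u′⇝v′))

  Agree-N²⇒σ-equivalent : ∀ {M M′} → n (frame M) ≤ N → n (frame M′) ≤ N →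
    ∀ {u u′} → Agree (N * N) M u M′ u′ → ∀ φ → msig φ ⊆ σ → eval M u φ ≡ eval M′ u′ φ
  Agree-N²⇒σ-equivalent M≤N M′≤N u≈u′ φ φ⊆σ =
    Agree⇒σ-equivalent M≤N M′≤N (Stable-N² M≤N M′≤N) φ φ⊆σ u≈u′

  msig-Ψ : ∀ i {φ} → φ ∈ Ψ i → msig φ ⊆ σ
  msig-Ψ zero    φ∈ with a , a∈ , refl ← ∈-map⁻ var φ∈ = λ { (here refl) → a∈ }
  msig-Ψ (suc i) φ∈ with ∈-++⁻ (Ψ i) φ∈
  ... | inj₁ φ∈Ψi = msig-Ψ i φ∈Ψi
  ... | inj₂ φ∈new with ls , ls∈ , refl ← ∈-map⁻ (dia ∘ conj) φ∈new = λ a∈ →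
    let l , l∈ , a∈l = msig-conj ls a∈ in msig-Ψ i (∈-literals⁻ (Ψ i) (proj₂ (∈-listsUpTo⁻ N _ ls∈) l∈)) a∈l

  length-msubs-Ψ : ∀ i {φ} → φ ∈ Ψ i → length (msubs φ) ≤ ΨtreeSize N i
  length-msubs-Ψ zero    φ∈ with a , _ , refl ← ∈-map⁻ var φ∈ = ≤-refl
  length-msubs-Ψ (suc i) φ∈ with ∈-++⁻ (Ψ i) φ∈
  ... | inj₁ φ∈Ψi = ≤-trans (length-msubs-Ψ i φ∈Ψi) (m≤m+n _ _)
  ... | inj₂ φ∈new with ls , ls∈ , refl ← ∈-map⁻ (dia ∘ conj) φ∈new =
    let len≤N , ls⊆ = ∈-listsUpTo⁻ N _ ls∈
        conj≤ = length-msubs-conj ls (All.tabulate (λ l∈ → length-msubs-Ψ i (∈-literals⁻ (Ψ i) (ls⊆ l∈))))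
    in ≤-trans (s≤s (s≤s (s≤s (≤-trans conj≤ (s≤s (*-monoˡ-≤ (2 + ΨtreeSize N i) len≤N))))))
               (m≤n+m _ (ΨtreeSize N i))

  length-Ψ : ∀ i → length (Ψ i) ≤ evalPoly (Ψlengthₚ N i) (length σ)
  length-Ψ zero    = ≤-reflexive (trans (length-map var σ) (sym (evalPoly-Xₚ (length σ))))
  length-Ψ (suc i) = begin
    length (Ψ i ++ map (dia ∘ conj) (listsUpTo N (literals (Ψ i))))
      ≡⟨ trans (length-++ (Ψ i)) (cong (length (Ψ i) +_) (length-map (dia ∘ conj) (listsUpTo N (literals (Ψ i))))) ⟩
    length (Ψ i) + length (listsUpTo N (literals (Ψ i)))
      ≤⟨ +-monoʳ-≤ (length (Ψ i)) (length-listsUpTo N (literals (Ψ i))) ⟩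
    length (Ψ i) + suc (length (literals (Ψ i))) ^ N
      ≡⟨ cong (λ m → length (Ψ i) + suc m ^ N) (trans (length-literals (Ψ i)) (*-comm (length (Ψ i)) 2)) ⟩
    length (Ψ i) + (1 + 2 * length (Ψ i)) ^ N
      ≤⟨ +-mono-≤ IH (^-monoˡ-≤ N (s≤s (*-monoʳ-≤ 2 IH))) ⟩
    e + (1 + 2 * e) ^ N
      ≡⟨ sym eval-step ⟩
    evalPoly (Ψlengthₚ N (suc i)) m
      ∎
    where
    open ≤-Reasoning
    m = length σ
    e = evalPoly (Ψlengthₚ N i) m
    IH = length-Ψ i
    eval-step : evalPoly (Ψlengthₚ N (suc i)) m ≡ e + (1 + 2 * e) ^ N
    eval-step = begin-equality
      evalPoly (Ψlengthₚ N i +ₚ (constₚ 1 +ₚ 2 ·ₚ Ψlengthₚ N i) ^ₚ N) m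
        ≡⟨ evalPoly-+ₚ m (Ψlengthₚ N i) _ ⟩
      e + evalPoly ((constₚ 1 +ₚ 2 ·ₚ Ψlengthₚ N i) ^ₚ N) m
        ≡⟨ cong (e +_) (evalPoly-^ₚ m (constₚ 1 +ₚ 2 ·ₚ Ψlengthₚ N i) N) ⟩
      e + evalPoly (constₚ 1 +ₚ 2 ·ₚ Ψlengthₚ N i) m ^ N
        ≡⟨ cong (λ b → e + b ^ N) (evalPoly-+ₚ m (constₚ 1) (2 ·ₚ Ψlengthₚ N i)) ⟩
      e + (evalPoly (constₚ 1) m + evalPoly (2 ·ₚ Ψlengthₚ N i) m) ^ N
        ≡⟨ cong (λ b → e + b ^ N) (cong₂ _+_ (evalPoly-constₚ m 1) (evalPoly-·ₚ m 2 (Ψlengthₚ N i))) ⟩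
      e + (1 + 2 * e) ^ N
        ∎

-- Translations between modal and propositional formulas

module Translation (F : PFrame) (rename : Fin (n F) → Atom → Atom) where

  translate : Fin (n F) → MForm → PForm
  boxed : Fin (n F) → MForm → Fin (n F) → PForm

  translate w (var a)   = pvar (rename w a)
  translate w top       = ptop
  translate w (neg φ)   = pneg (translate w φ)
  translate w (and φ ψ) = pand (translate w φ) (translate w ψ)
  translate w (box φ)   = pconj (map (boxed w φ) (allFin (n F)))

  boxed w φ u = if R F w u then translate u φ else ptop

  translate-eval : ∀ (v : Atom → Bool) (V : Atom → Fin (n F) → Bool) → (∀ u a → v (rename u a) ≡ V a u) →
    ∀ w φ → peval v (translate w φ) ≡ meval F V w φ
  translate-eval v V v≡V w (var a)   = v≡V w a
  translate-eval v V v≡V w top       = refl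
  translate-eval v V v≡V w (neg φ)   = cong not (translate-eval v V v≡V w φ)
  translate-eval v V v≡V w (and φ ψ) = cong₂ _∧_ (translate-eval v V v≡V w φ) (translate-eval v V v≡V w ψ)
  translate-eval v V v≡V w (box φ)   = go (allFin (n F))
    where
    go : ∀ us → peval v (pconj (map (boxed w φ) us)) ≡ allB (λ u → if R F w u then meval F V u φ else true) us
    go []       = refl
    go (u ∷ us) with R F w u
    ... | true  = cong₂ _∧_ (translate-eval v V v≡V u φ) (go us)
    ... | false = go us

  psig-translate : ∀ w φ {c} → c ∈ psig (translate w φ) → ∃[ u ] ∃[ a ] (c ≡ rename u a)
  psig-translate w (var a)   (here refl) = w , a , refl
  psig-translate w (neg φ)   c∈ = psig-translate w φ c∈
  psig-translate w (and φ ψ) c∈ with ∈-++⁻ (psig (translate w φ)) c∈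
  ... | inj₁ c∈φ = psig-translate w φ c∈φ
  ... | inj₂ c∈ψ = psig-translate w ψ c∈ψ
  psig-translate w (box φ)   c∈ with psig-pconj (map (boxed w φ) (allFin (n F))) c∈
  ... | χ , χ∈ , c∈χ with ∈-map⁻ (boxed w φ) χ∈
  ... | u , _ , refl with R F w u
  ... | true = psig-translate u φ c∈χ

  pieces : MForm → Fin (n F) → List PForm
  pieces (box φ) u = pconj-suffixes (map (boxed u φ) (allFin (n F)))
  pieces φ       u = translate u φ ∷ []

  length-pieces : ∀ φ u → length (pieces φ u) ≤ suc (n F)
  length-pieces (box φ) u = ≤-reflexive (begin
    length (pconj-suffixes (map (boxed u φ) (allFin (n F)))) ≡⟨ length-pconj-suffixes (map (boxed u φ) (allFin (n F))) ⟩
    suc (length (map (boxed u φ) (allFin (n F))))          ≡⟨ cong suc (length-map _ (allFin (n F))) ⟩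
    suc (length (allFin (n F)))                             ≡⟨ cong suc (length-allFin (n F)) ⟩
    suc (n F)                                               ∎)
    where open ≡-Reasoning
  length-pieces (var _)   u = s≤s z≤n
  length-pieces top       u = s≤s z≤n
  length-pieces (neg _)   u = s≤s z≤n
  length-pieces (and _ _) u = s≤s z≤n

  allPieces : MForm → List PForm
  allPieces φ = ptop ∷ concatMap (λ χ → concatMap (pieces χ) (allFin (n F))) (deduplicate _≟ᴹ_ (msubs φ))

  length-allPieces : ∀ φ → length (allPieces φ) ≤ suc (msize φ * (n F * suc (n F)))
  length-allPieces φ rewrite msize-≡ φ =
    s≤s (length-concatMap-≤ _ (deduplicate _≟ᴹ_ (msubs φ)) (All.tabulate λ {χ} _ → per-subformula χ))
    where
    per-subformula : ∀ χ → length (concatMap (pieces χ) (allFin (n F))) ≤ n F * suc (n F)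
    per-subformula χ = ≤-trans (length-concatMap-≤ (pieces χ) (allFin (n F)) (All.tabulate λ {u} _ → length-pieces χ u))
                               (≤-reflexive (cong (_* suc (n F)) (length-allFin (n F))))

  ∈-allPieces : ∀ φ {χ ψ} u → χ ∈ msubs φ → ψ ∈ pieces χ u → ψ ∈ allPieces φ
  ∈-allPieces φ {χ} u χ∈ ψ∈ =
    there (∈-concatMap⁺ (λ χ → concatMap (pieces χ) (allFin (n F)))
            (Any.map (λ { refl → ∈-concatMap⁺ (pieces χ) (Any.map (λ { refl → ψ∈ }) (∈-allFin u)) })
                     (∈-deduplicate⁺ _≟ᴹ_ χ∈)))

  psubs-translate⊆allPieces : ∀ φ χ → msubs χ ⊆ msubs φ → ∀ u → psubs (translate u χ) ⊆ allPieces φ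
  psubs-translate⊆allPieces φ (var a) χ⊆ u (here refl) = ∈-allPieces φ u (χ⊆ (here refl)) (here refl)
  psubs-translate⊆allPieces φ top χ⊆ u (here refl) = here refl
  psubs-translate⊆allPieces φ (neg χ) χ⊆ u (here refl) = ∈-allPieces φ u (χ⊆ (here refl)) (here refl)
  psubs-translate⊆allPieces φ (neg χ) χ⊆ u (there ψ∈) = psubs-translate⊆allPieces φ χ (χ⊆ ∘ there) u ψ∈
  psubs-translate⊆allPieces φ (and χ χ′) χ⊆ u (here refl) = ∈-allPieces φ u (χ⊆ (here refl)) (here refl)
  psubs-translate⊆allPieces φ (and χ χ′) χ⊆ u (there ψ∈) with ∈-++⁻ (psubs (translate u χ)) ψ∈
  ... | inj₁ ψ∈χ  = psubs-translate⊆allPieces φ χ (χ⊆ ∘ there ∘ ∈-++⁺ˡ) u ψ∈χ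
  ... | inj₂ ψ∈χ′ = psubs-translate⊆allPieces φ χ′ (χ⊆ ∘ there ∘ ∈-++⁺ʳ (msubs χ)) u ψ∈χ′
  psubs-translate⊆allPieces φ (box χ) χ⊆ u ψ∈ with psubs-pconj (map (boxed u χ) (allFin (n F))) ψ∈
  ... | inj₁ suffix = ∈-allPieces φ u (χ⊆ (here refl)) suffix
  ... | inj₂ (θ , θ∈ , ψ∈θ) with ∈-map⁻ (boxed u χ) θ∈
  ...   | u′ , _ , refl with R F u u′ | ψ∈θ
  ...     | true  | ψ∈χ        = psubs-translate⊆allPieces φ χ (χ⊆ ∘ there) u′ ψ∈χ
  ...     | false | here refl  = here refl

  psize-translate : ∀ w φ → psize (translate w φ) ≤ suc (msize φ * (n F * suc (n F)))
  psize-translate w φ = ≤-trans (psize-≤ (translate w φ) (psubs-translate⊆allPieces φ φ id w)) (length-allPieces φ)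

psubst : (Atom → MForm) → PForm → MForm
psubst s (pvar c)   = s c
psubst s ptop       = top
psubst s (pneg θ)   = neg (psubst s θ)
psubst s (pand θ η) = and (psubst s θ) (psubst s η)

psubst-eval : ∀ F V w s θ → meval F V w (psubst s θ) ≡ peval (λ c → meval F V w (s c)) θ
psubst-eval F V w s (pvar c)   = refl
psubst-eval F V w s ptop       = refl
psubst-eval F V w s (pneg θ)   = cong not (psubst-eval F V w s θ)
psubst-eval F V w s (pand θ η) = cong₂ _∧_ (psubst-eval F V w s θ) (psubst-eval F V w s η)

msig-psubst : ∀ s θ {a} → a ∈ msig (psubst s θ) → ∃[ c ] (c ∈ psig θ × a ∈ msig (s c))
msig-psubst s (pvar c)   a∈ = c , here refl , a∈
msig-psubst s (pneg θ)   a∈ = msig-psubst s θ a∈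
msig-psubst s (pand θ η) a∈ with ∈-++⁻ (msig (psubst s θ)) a∈
... | inj₁ a∈θ = let c , c∈ , a∈c = msig-psubst s θ a∈θ in c , ∈-++⁺ˡ c∈ , a∈c
... | inj₂ a∈η = let c , c∈ , a∈c = msig-psubst s η a∈η in c , ∈-++⁺ʳ (psig θ) c∈ , a∈c

module _ (s : Atom → MForm) (E : List MForm) where

  psubst-∈ : ∀ θ {η} → η ∈ psubs θ → psubst s η ∈ map (psubst s) (deduplicate _≟ᴾ_ (psubs θ)) ++ E
  psubst-∈ θ η∈ = ∈-++⁺ˡ (∈-map⁺ (psubst s) (∈-deduplicate⁺ _≟ᴾ_ η∈))

  msubs-psubst⊆ : ∀ θ η → psubs η ⊆ psubs θ → (∀ {c} → c ∈ psig η → msubs (s c) ⊆ E) →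
    msubs (psubst s η) ⊆ map (psubst s) (deduplicate _≟ᴾ_ (psubs θ)) ++ E
  msubs-psubst⊆ θ (pvar c)   η⊆ sE χ∈          = ∈-++⁺ʳ _ (sE (here refl) χ∈)
  msubs-psubst⊆ θ ptop       η⊆ sE (here refl) = psubst-∈ θ (η⊆ (here refl))
  msubs-psubst⊆ θ (pneg η)   η⊆ sE (here refl) = psubst-∈ θ (η⊆ (here refl))
  msubs-psubst⊆ θ (pneg η)   η⊆ sE (there χ∈)  = msubs-psubst⊆ θ η (η⊆ ∘ there) sE χ∈
  msubs-psubst⊆ θ (pand η ι) η⊆ sE (here refl) = psubst-∈ θ (η⊆ (here refl))
  msubs-psubst⊆ θ (pand η ι) η⊆ sE (there χ∈) with ∈-++⁻ (msubs (psubst s η)) χ∈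
  ... | inj₁ χ∈η = msubs-psubst⊆ θ η (η⊆ ∘ there ∘ ∈-++⁺ˡ) (sE ∘ ∈-++⁺ˡ) χ∈η
  ... | inj₂ χ∈ι = msubs-psubst⊆ θ ι (η⊆ ∘ there ∘ ∈-++⁺ʳ (psubs η)) (sE ∘ ∈-++⁺ʳ (psig η)) χ∈ι

  msize-psubst : ∀ θ → (∀ {c} → c ∈ psig θ → msubs (s c) ⊆ E) → msize (psubst s θ) ≤ psize θ + length E
  msize-psubst θ sE = begin
    msize (psubst s θ)                            ≤⟨ msize-≤ (psubst s θ) (msubs-psubst⊆ θ θ id sE) ⟩
    length (map (psubst s) θ-subs ++ E)           ≡⟨ length-++ (map (psubst s) θ-subs) ⟩
    length (map (psubst s) θ-subs) + length E     ≡⟨ cong (_+ length E) (length-map (psubst s) θ-subs) ⟩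
    length θ-subs + length E                      ≡⟨ cong (_+ length E) (sym (psize-≡ θ)) ⟩
    psize θ + length E                            ∎
    where
    open ≤-Reasoning
    θ-subs = deduplicate _≟ᴾ_ (psubs θ)

-- Padding, and a lower bound on uniform interpolants

negations : ℕ → PForm → PForm
negations zero    φ = φ
negations (suc j) φ = pneg (negations j φ)

negations-eval : ∀ j φ b → ∃[ b′ ] (∀ v → peval v φ ≡ b′ → peval v (negations j φ) ≡ b)
negations-eval zero    φ b = b , λ _ φ≡b → φ≡b
negations-eval (suc j) φ b =
  let b′ , correct = negations-eval j φ (not b) in
  b′ , λ v φ≡b′ → trans (cong not (correct v φ≡b′)) (Bool.not-involutive b)

psig-negations : ∀ j p → psig (negations j (pvar p)) ≡ p ∷ []
psig-negations zero    p = refl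
psig-negations (suc j) p = psig-negations j p

psig-negations-∈ : ∀ j p {c} → c ∈ psig (negations j (pvar p)) → c ≡ p
psig-negations-∈ j p c∈ with here c≡p ← subst (_ ∈_) (psig-negations j p) c∈ = c≡p

∈-psubs-negations : ∀ j p {χ} → χ ∈ psubs (negations j (pvar p)) → ∃[ i ] (χ ≡ negations i (pvar p))
∈-psubs-negations zero    p (here refl) = 0 , refl
∈-psubs-negations (suc j) p (here refl) = suc j , refl
∈-psubs-negations (suc j) p (there χ∈)  = ∈-psubs-negations j p χ∈

length-psubs-negations : ∀ j p → length (psubs (negations j (pvar p))) ≡ suc j
length-psubs-negations zero    p = refl
length-psubs-negations (suc j) p = cong suc (length-psubs-negations j p)

Unique-psubs-negations : ∀ j p → Unique (psubs (negations j (pvar p)))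
Unique-psubs-negations zero    p = [] ∷ []
Unique-psubs-negations (suc j) p =
  All.tabulate (λ χ∈ eq → psubs-longer-∉ {negations j (pvar p)} ≤-refl (subst (_∈ _) (sym eq) χ∈))
  ∷ Unique-psubs-negations j p

psize-pad : ∀ ξ j p → p ∉ psig ξ → psize (pand ξ (negations j (pvar p))) ≡ suc (psize ξ + suc j)
psize-pad ξ j p p∉ξ = ≤-antisym upper (≤-trans (≤-reflexive (sym length-U)) (≤-psize (pand ξ P) Unique-U U⊆))
  where
  P = negations j (pvar p)
  dd = deduplicate _≟ᴾ_
  size-P : psize P ≡ suc j
  size-P = trans (psize-Unique P (Unique-psubs-negations j p)) (length-psubs-negations j p)
  upper : psize (pand ξ P) ≤ suc (psize ξ + suc j)
  upper = ≤-trans (psize-pand ξ P) (≤-reflexive (cong (λ m → suc (psize ξ + m)) size-P))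
  U = pand ξ P ∷ (dd (psubs ξ) ++ psubs P)
  length-U : length U ≡ suc (psize ξ + suc j)
  length-U = cong suc (trans (length-++ (dd (psubs ξ))) (cong₂ _+_ (sym (psize-≡ ξ)) (length-psubs-negations j p)))
  ξ∩P=∅ : ∀ {χ} → χ ∈ dd (psubs ξ) × χ ∈ psubs P → ⊥
  ξ∩P=∅ {χ} (χ∈ξ , χ∈P) with i , refl ← ∈-psubs-negations j p χ∈P =
    p∉ξ (psig-psubs ξ (∈-deduplicate⁻ _≟ᴾ_ (psubs ξ) χ∈ξ) (subst (p ∈_) (sym (psig-negations i p)) (here refl)))
  head-new : ∀ {χ} → χ ∈ dd (psubs ξ) ++ psubs P → pand ξ P ≢ χ
  head-new χ∈ eq with ∈-++⁻ (dd (psubs ξ)) (subst (_∈ _) (sym eq) χ∈)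
  ... | inj₁ χ∈ξ = psubs-longer-∉ (length-psubs-pandˡ ξ P) (∈-deduplicate⁻ _≟ᴾ_ (psubs ξ) χ∈ξ)
  ... | inj₂ χ∈P = psubs-longer-∉ (length-psubs-pandʳ ξ P) χ∈P
  Unique-U : Unique U
  Unique-U = All.tabulate head-new ∷ Unique.++⁺ (deduplicate-! _≟ᴾ_ (psubs ξ)) (Unique-psubs-negations j p) ξ∩P=∅
  U⊆ : U ⊆ psubs (pand ξ P)
  U⊆ (here refl) = here refl
  U⊆ (there χ∈) with ∈-++⁻ (dd (psubs ξ)) χ∈
  ... | inj₁ χ∈ξ = there (∈-++⁺ˡ (∈-deduplicate⁻ _≟ᴾ_ (psubs ξ) χ∈ξ))
  ... | inj₂ χ∈P = there (∈-++⁺ʳ (psubs ξ) χ∈P)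

chain : ℕ → PForm
chain zero    = pvar 0
chain (suc k) = pand (pvar (suc k)) (chain k)

psig-chain-≤ : ∀ k {a} → a ∈ psig (chain k) → a ≤ k
psig-chain-≤ zero    (here refl) = z≤n
psig-chain-≤ (suc k) (here refl) = ≤-refl
psig-chain-≤ (suc k) (there a∈)  = m≤n⇒m≤1+n (psig-chain-≤ k a∈)

Unique-psig-chain : ∀ k → Unique (psig (chain k))
Unique-psig-chain zero    = [] ∷ []
Unique-psig-chain (suc k) = All.tabulate (λ a∈ eq → 1+n≰n (subst (_≤ k) (sym eq) (psig-chain-≤ k a∈))) ∷ Unique-psig-chain k

length-psig-chain : ∀ k → length (psig (chain k)) ≡ suc k
length-psig-chain zero    = refl
length-psig-chain (suc k) = cong suc (length-psig-chain k)

Unique-psubs-chain : ∀ k → Unique (psubs (chain k))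
Unique-psubs-chain zero    = [] ∷ []
Unique-psubs-chain (suc k) = All.tabulate head-new ∷ All.tabulate atom-new ∷ Unique-psubs-chain k
  where
  head-new : ∀ {χ} → χ ∈ pvar (suc k) ∷ psubs (chain k) → chain (suc k) ≢ χ
  head-new (here refl) ()
  head-new (there χ∈) eq =
    psubs-longer-∉ (length-psubs-pandʳ (pvar (suc k)) (chain k)) (subst (_∈ _) (sym eq) χ∈)
  atom-new : ∀ {χ} → χ ∈ psubs (chain k) → pvar (suc k) ≢ χ
  atom-new χ∈ eq = 1+n≰n (psig-chain-≤ k (psig-psubs (chain k) (subst (_∈ _) (sym eq) χ∈) (here refl)))

length-psubs-chain : ∀ k → length (psubs (chain k)) ≡ suc (2 * k)
length-psubs-chain zero    = refl
length-psubs-chain (suc k) = cong (suc ∘ suc) (trans (length-psubs-chain k) (sym (+-suc k (k + 0))))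

psize-chain : ∀ k → psize (chain k) ≡ suc (2 * k)
psize-chain k = trans (psize-Unique (chain k) (Unique-psubs-chain k)) (length-psubs-chain k)

chain⇒atom : ∀ v k {a} → peval v (chain k) ≡ true → a ∈ psig (chain k) → v a ≡ true
chain⇒atom v zero    chain✓ (here refl) = chain✓
chain⇒atom v (suc k) chain✓ (here refl) = proj₁ (∧-true⁻ chain✓)
chain⇒atom v (suc k) chain✓ (there a∈)  = chain⇒atom v k (proj₂ (∧-true⁻ chain✓)) a∈

chain-true : ∀ k → peval (λ _ → true) (chain k) ≡ true
chain-true zero    = refl
chain-true (suc k) = chain-true k

uniform-interpolant-chain-mentions-all : ∀ k {χ} → IsUniformInterpolant (psig (chain k)) (chain k) χ →
  psig (chain k) ⊆ psig χ
uniform-interpolant-chain-mentions-all k {χ} (_ , chain⇒χ , strongest) {a} a∈ =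
  decidable-stable (a ∈? psig χ) λ a∉χ →
    false≢true (trans (sym (dec-false (a ∈? psig χ) a∉χ)) (implication-elim (χ⇒a v) χ✓))
  where
  v : Atom → Bool
  v c = does (c ∈? psig χ)
  χ⇒a : Tautology (pimp χ (pvar a))
  χ⇒a = strongest (pvar a) (λ _ a∈chain → a∈chain) (λ v → implication-intro (λ chain✓ → chain⇒atom v k chain✓ a∈))
  χ✓ : peval v χ ≡ true
  χ✓ = trans (peval-cong χ (λ c∈ → dec-true (_ ∈? psig χ) c∈))
             (implication-elim (chain⇒χ (λ _ → true)) (chain-true k))
  false≢true : false ≢ true
  false≢true ()

uniform-interpolant-chain-size : ∀ k {χ} → IsUniformInterpolant (psig (chain k)) (chain k) χ → suc k ≤ psize χ
uniform-interpolant-chain-size k {χ} χ-interpolant = begin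
  suc k                             ≡⟨ sym (trans (length-map pvar (psig (chain k))) (length-psig-chain k)) ⟩
  length (map pvar (psig (chain k))) ≤⟨ ≤-psize χ (Unique.map⁺ pvar-injective (Unique-psig-chain k)) atoms⊆ ⟩
  psize χ                           ∎
  where
  open ≤-Reasoning
  pvar-injective : ∀ {a b} → pvar a ≡ pvar b → a ≡ b
  pvar-injective refl = refl
  atoms⊆ : map pvar (psig (chain k)) ⊆ psubs χ
  atoms⊆ p∈ with a , a∈ , refl ← ∈-map⁻ pvar p∈ =
    pvar-∈-psubs χ (uniform-interpolant-chain-mentions-all k {χ} χ-interpolant a∈)

UniformInterpolantsBoundedBy : (ℕ → ℕ) → Set
UniformInterpolantsBoundedBy f =
  ∀ (ξ : PForm) (σ : Sig) → σ ⊆ psig ξ → Σ PForm λ χ → IsUniformInterpolant σ ξ χ × psize χ ≤ f (psize ξ)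

uniform-interpolation-bound-grows : ∀ {f} → UniformInterpolantsBoundedBy f → ∀ m → m < f (suc (2 * m))
uniform-interpolation-bound-grows {f} interpolate m
  with χ , χ-interpolant , χ≤ ← interpolate (chain m) (psig (chain m)) (λ a∈ → a∈) =
  ≤-trans (uniform-interpolant-chain-size m {χ} χ-interpolant) (≤-trans χ≤ (≤-reflexive (cong f (psize-chain m))))

-- Coding atoms

module Coding (K : ℕ) {{_ : NonZero K}} where

  code : ℕ → Atom → Atom
  code r a = r + a * K

  slot : Atom → ℕ
  slot c = c % K

  payload : Atom → Atom
  payload c = c / K

  slot-code : ∀ {r} a → r < K → slot (code r a) ≡ r
  slot-code {r} a r<K = trans ([m+kn]%n≡m%n r a K) (m<n⇒m%n≡m r<K)

  payload-code : ∀ {r} a → r < K → payload (code r a) ≡ a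
  payload-code {r} a r<K = begin
    (r + a * K) / K     ≡⟨ +-distrib-/ r (a * K) no-carry ⟩
    r / K + a * K / K   ≡⟨ cong₂ _+_ (m<n⇒m/n≡0 r<K) (m*n/n≡m a K) ⟩
    a                   ∎
    where
    open ≡-Reasoning
    no-carry : r % K + a * K % K < K
    no-carry = subst (_< K) (sym (trans (cong₂ _+_ (m<n⇒m%n≡m r<K) (m*n%n≡0 a K)) (+-identityʳ r))) r<K

  bySlot : ∀ {A : Set} → (ℕ → Atom → A) → Atom → A
  bySlot g c = g (slot c) (payload c)

  bySlot-code : ∀ {A : Set} (g : ℕ → Atom → A) {r} a → r < K → bySlot g (code r a) ≡ g r a
  bySlot-code g a r<K = cong₂ g (slot-code a r<K) (payload-code a r<K)

  bySlot-slot : ∀ {A : Set} (g : ℕ → Atom → A) c {r} → slot c ≡ r → bySlot g c ≡ g r (payload c)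
  bySlot-slot g c slot≡r = cong (λ r → g r (payload c)) slot≡r

extendAlong : ∀ {n} {A : Set} → (Fin n → ℕ) → A → (Fin n → A) → ℕ → A
extendAlong e default f m with Fin.any? (λ w → e w ℕ.≟ m)
... | yes (w , _) = f w
... | no _        = default

extendAlong-correct : ∀ {n} {A : Set} {e : Fin n → ℕ} → Injective _≡_ _≡_ e →
  ∀ default (f : Fin n → A) w → extendAlong e default f (e w) ≡ f w
extendAlong-correct {e = e} e-injective default f w with Fin.any? (λ w′ → e w′ ℕ.≟ e w)
... | yes (w′ , ew′≡ew) = cong f (e-injective ew′≡ew)
... | no ∄w′            = ⊥-elim (∄w′ (w , refl))

-- The strongest implicate

maxSize : List PFrame → ℕ
maxSize []       = 0
maxSize (F ∷ Fs) = n F ⊔ maxSize Fs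

n≤maxSize : ∀ Fs {F} → F ∈ Fs → n F ≤ maxSize Fs
n≤maxSize (F ∷ Fs) (here refl) = m≤m⊔n (n F) (maxSize Fs)
n≤maxSize (G ∷ Fs) (there F∈)  = ≤-trans (n≤maxSize Fs F∈) (m≤n⊔m (n G) (maxSize Fs))

All-lookup⁻ : ∀ {A : Set} {P : A → Set} xs → (∀ i → P (lookup xs i)) → All P xs
All-lookup⁻ {P = P} xs P[xs] = All.tabulate λ x∈ → subst P (sym (Any.lookup-index x∈)) (P[xs] (Any.index x∈))

nthOrTop : List MForm → ℕ → MForm
nthOrTop []       j       = top
nthOrTop (φ ∷ φs) zero    = φ
nthOrTop (φ ∷ φs) (suc j) = nthOrTop φs j

nthOrTop-lookup : ∀ φs (j : Fin (length φs)) → nthOrTop φs (toℕ j) ≡ lookup φs j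
nthOrTop-lookup (φ ∷ φs) Fin.zero    = refl
nthOrTop-lookup (φ ∷ φs) (Fin.suc j) = nthOrTop-lookup φs j

nthOrTop-∈ : ∀ φs j → nthOrTop φs j ∈ top ∷ φs
nthOrTop-∈ []       j       = here refl
nthOrTop-∈ (φ ∷ φs) zero    = there (here refl)
nthOrTop-∈ (φ ∷ φs) (suc j) with nthOrTop-∈ φs j
... | here eq = here eq
... | there φ∈ = there (there φ∈)

IsStrongestImplicate-cong : ∀ {L L′ : MForm → Set} → (∀ φ → L φ → L′ φ) → (∀ φ → L′ φ → L φ) →
  ∀ {σ φ χ} → IsStrongestImplicate L σ φ χ → IsStrongestImplicate L′ σ φ χ
IsStrongestImplicate-cong L⇒L′ L′⇒L (χ⊆σ , φ→χ , strongest) =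
  χ⊆σ , L⇒L′ _ φ→χ , λ ψ ψ⊆σ φ→ψ → L⇒L′ _ (strongest ψ ψ⊆σ (L′⇒L _ φ→ψ))

module Construction (Fs : List PFrame) where

  k N : ℕ
  k = length Fs
  N = maxSize Fs

  Frame : Fin k → PFrame
  Frame = lookup Fs

  Frame≤N : ∀ i → n (Frame i) ≤ N
  Frame≤N i = n≤maxSize Fs (∈-lookup i)

  Log⁺ : ∀ {ψ} → (∀ i → ValidAt (Frame i) ψ) → Log Fs ψ
  Log⁺ = All-lookup⁻ Fs

  Log⁻ : ∀ {ψ} → Log Fs ψ → ∀ i → ValidAt (Frame i) ψ
  Log⁻ valid i = All.lookup valid (∈-lookup i)

  -- Slot 0 holds the atoms qⱼ standing for the j-th characteristic formula, slot 1 the padding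
  -- atom, and slot 2 + (base + offset i w) the copy of every atom at world w of frame i; the
  -- copies with base 0 describe models of φ, those with base k * N models of a candidate ψ.
  open Coding (2 + 2 * (k * N))

  offset : (i : Fin k) → Fin (n (Frame i)) → ℕ
  offset i w = toℕ i * N + toℕ w

  offset<kN : ∀ i w → offset i w < k * N
  offset<kN i w = begin-strict
    toℕ i * N + toℕ w <⟨ +-monoʳ-< (toℕ i * N) (≤-trans (toℕ<n w) (Frame≤N i)) ⟩
    toℕ i * N + N     ≡⟨ +-comm (toℕ i * N) N ⟩
    suc (toℕ i) * N   ≤⟨ *-monoˡ-≤ N (toℕ<n i) ⟩
    k * N             ∎
    where open ≤-Reasoning

  shifted-offset-injective : ∀ base i → Injective _≡_ _≡_ (λ w → base + offset i w)
  shifted-offset-injective base i eq = toℕ-injective (+-cancelˡ-≡ (toℕ i * N) _ _ (+-cancelˡ-≡ base _ _ eq))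

  copySlot : ℕ → (i : Fin k) → Fin (n (Frame i)) → ℕ
  copySlot base i w = 2 + (base + offset i w)

  copySlot<K : ∀ {base} → base ≤ k * N → ∀ i w → copySlot base i w < 2 + 2 * (k * N)
  copySlot<K {base} base≤ i w = s≤s (s≤s (begin-strict
    base + offset i w  <⟨ +-monoʳ-< base (offset<kN i w) ⟩
    base + k * N       ≤⟨ +-mono-≤ base≤ (m≤m+n (k * N) 0) ⟩
    2 * (k * N)        ∎))
    where open ≤-Reasoning

  qAtom : ℕ → Atom
  qAtom = code 0

  padAtom : Atom
  padAtom = code 1 0

  copyAtom : ℕ → (i : Fin k) → Fin (n (Frame i)) → Atom → Atom
  copyAtom base i w = code (copySlot base i w)

  CopyAtom : ℕ → Atom → Set
  CopyAtom base c = ∃[ i ] ∃[ w ] ∃[ a ] (c ≡ copyAtom base i w a)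

  slot-qAtom : ∀ j → slot (qAtom j) ≡ 0
  slot-qAtom j = slot-code j (s≤s z≤n)

  slot-padAtom : slot padAtom ≡ 1
  slot-padAtom = slot-code 0 (s≤s (s≤s z≤n))

  slot-CopyAtom : ∀ {base c} → base ≤ k * N → CopyAtom base c → ∃[ o ] (o < k * N × slot c ≡ 2 + (base + o))
  slot-CopyAtom base≤ (i , w , a , refl) = offset i w , offset<kN i w , slot-code a (copySlot<K base≤ i w)

  slotwise : (ℕ → Bool) → Bool → (ℕ → Atom → Bool) → ℕ → Atom → Bool
  slotwise q pad copies zero          j = q j
  slotwise q pad copies (suc zero)    _ = pad
  slotwise q pad copies (suc (suc r)) a = copies r a

  copiesOf : ℕ → (i : Fin k) → (Atom → Fin (n (Frame i)) → Bool) → ℕ → Atom → Bool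
  copiesOf base i V r a = extendAlong (λ w → base + offset i w) false (λ w → V a w) r

  slotwise-copyAtom : ∀ {base} → base ≤ k * N → ∀ i V q pad w a →
    bySlot (slotwise q pad (copiesOf base i V)) (copyAtom base i w a) ≡ V a w
  slotwise-copyAtom {base} base≤ i V q pad w a =
    trans (bySlot-code (slotwise q pad (copiesOf base i V)) a (copySlot<K base≤ i w))
          (extendAlong-correct (shifted-offset-injective base i) false (λ w → V a w) w)

  Qₚ : Poly
  Qₚ = Ψlengthₚ N (N * N)

  treeBound blowup entryBound : ℕ
  treeBound  = ΨtreeSize N (N * N)
  blowup     = N * suc N
  entryBound = suc (2 * (3 + (1 + suc (treeBound * blowup))))

  Hₚ Gₚ p₁ p₂ : Poly
  Hₚ = constₚ (4 + k * 5) +ₚ (k * blowup) ·ₚ Xₚ +ₚ (k * suc entryBound) ·ₚ Qₚ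
  Gₚ = constₚ 1 +ₚ treeBound ·ₚ Qₚ
  p₁ = 2 ·ₚ Xₚ
  p₂ = constₚ 1 +ₚ 2 ·ₚ (Hₚ +ₚ Gₚ)

  module Profiles (σ : Sig) where

    σ₀ : List Atom
    σ₀ = deduplicate ℕ._≟_ σ

    open CharacteristicFormulas N σ₀ using (Ψ; agree; Agree-N²⇒σ-equivalent; length-Ψ; length-msubs-Ψ; msig-Ψ) public

    ψs : List MForm
    ψs = Ψ (N * N)

    Q : ℕ
    Q = length ψs

    qAtoms : List Atom
    qAtoms = map (qAtom ∘ toℕ) (allFin Q)

    slot-∈-qAtoms : ∀ {c} → c ∈ qAtoms → slot c ≡ 0
    slot-∈-qAtoms c∈ with j , _ , refl ← ∈-map⁻ (qAtom ∘ toℕ) c∈ = slot-qAtom (toℕ j)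

    translateAt : ℕ → (i : Fin k) → MForm → PForm
    translateAt base i = Translation.translate (Frame i) (copyAtom base i) (point (Frame i))

    profileEntry : ℕ → Fin k → Fin Q → PForm
    profileEntry base i j = piff (pvar (qAtom (toℕ j))) (translateAt base i (lookup ψs j))

    profile : ℕ → Fin k → PForm
    profile base i = pconj (map (profileEntry base i) (allFin Q))

    substitutionBySlot : ℕ → Atom → MForm
    substitutionBySlot zero    j = nthOrTop ψs j
    substitutionBySlot (suc _) _ = top

    substitution : Atom → MForm
    substitution = bySlot substitutionBySlot

    substitution-qAtom : ∀ j → substitution (qAtom (toℕ j)) ≡ lookup ψs j
    substitution-qAtom j = trans (bySlot-code substitutionBySlot (toℕ j) (s≤s z≤n)) (nthOrTop-lookup ψs j)

    translateAt-eval : ∀ base i v (V : Atom → Fin (n (Frame i)) → Bool) → (∀ w a → v (copyAtom base i w a) ≡ V a w) →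
      ∀ ψ → peval v (translateAt base i ψ) ≡ meval (Frame i) V (point (Frame i)) ψ
    translateAt-eval base i v V v≡V = Translation.translate-eval (Frame i) (copyAtom base i) v V v≡V (point (Frame i))

    profile-true⁺ : ∀ base i v → (∀ j → v (qAtom (toℕ j)) ≡ peval v (translateAt base i (lookup ψs j))) →
      peval v (profile base i) ≡ true
    profile-true⁺ base i v q≡ = pconj-true⁺ v _ (All.map⁺ (All.tabulate⁺ (λ j → biconditional-intro (q≡ j))))

    profile-true⁻ : ∀ base i v → peval v (profile base i) ≡ true →
      ∀ j → v (qAtom (toℕ j)) ≡ peval v (translateAt base i (lookup ψs j))
    profile-true⁻ base i v profile✓ j =
      biconditional-elim (All.lookup (All.map⁻ (pconj-true⁻ v _ profile✓)) (∈-allFin j))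

    pointValuation : ℕ → (i : Fin k) → (Atom → Fin (n (Frame i)) → Bool) → Bool → Atom → Bool
    pointValuation base i V pad =
      bySlot (slotwise (λ j → meval (Frame i) V (point (Frame i)) (nthOrTop ψs j)) pad (copiesOf base i V))

    module _ {base} (base≤ : base ≤ k * N) (i : Fin k) (V : Atom → Fin (n (Frame i)) → Bool) (pad : Bool) where

      private
        v = pointValuation base i V pad
        evalAtPoint = meval (Frame i) V (point (Frame i))

      pointValuation-translate : ∀ ψ → peval v (translateAt base i ψ) ≡ evalAtPoint ψ
      pointValuation-translate = translateAt-eval base i v V (slotwise-copyAtom base≤ i V _ pad)

      pointValuation-slot0 : ∀ c → slot c ≡ 0 → v c ≡ evalAtPoint (substitution c)
      pointValuation-slot0 c slot≡0 =
        trans (bySlot-slot (slotwise (evalAtPoint ∘ nthOrTop ψs) pad (copiesOf base i V)) c slot≡0)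
              (cong evalAtPoint (sym (bySlot-slot substitutionBySlot c slot≡0)))

      pointValuation-psubst : ∀ θ → psig θ ⊆ qAtoms → peval v θ ≡ evalAtPoint (psubst substitution θ)
      pointValuation-psubst θ θ⊆q = trans (peval-cong θ (λ {c} c∈ → pointValuation-slot0 c (slot-∈-qAtoms (θ⊆q c∈))))
                                          (sym (psubst-eval (Frame i) V (point (Frame i)) substitution θ))

      pointValuation-padAtom : v padAtom ≡ pad
      pointValuation-padAtom = bySlot-code (slotwise (evalAtPoint ∘ nthOrTop ψs) pad (copiesOf base i V)) 0 (s≤s (s≤s z≤n))

      pointValuation-profile : peval v (profile base i) ≡ true
      pointValuation-profile = profile-true⁺ base i v λ j → begin
        v (qAtom (toℕ j))                          ≡⟨ pointValuation-slot0 (qAtom (toℕ j)) (slot-qAtom (toℕ j)) ⟩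
        evalAtPoint (substitution (qAtom (toℕ j))) ≡⟨ cong evalAtPoint (substitution-qAtom j) ⟩
        evalAtPoint (lookup ψs j)                  ≡⟨ sym (pointValuation-translate (lookup ψs j)) ⟩
        peval v (translateAt base i (lookup ψs j)) ∎
        where open ≡-Reasoning

    readOff : ℕ → (i : Fin k) → (Atom → Bool) → Model
    readOff base i v = record { frame = Frame i ; valuation = λ a w → v (copyAtom base i w a) }

    readOff-translate : ∀ base i v ψ → peval v (translateAt base i ψ) ≡ eval (readOff base i v) (point (Frame i)) ψ
    readOff-translate base i v = translateAt-eval base i v _ (λ _ _ → refl)

    guard : MForm → Fin k → PForm
    guard ψ i = pimp (profile (k * N) i) (translateAt (k * N) i ψ)

    ψ* : MForm → PForm
    ψ* ψ = pconj (map (guard ψ) (allFin k))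

    χ⇒ψ-valid : ∀ θ → psig θ ⊆ qAtoms → ∀ ψ → Tautology (pimp θ (ψ* ψ)) →
      ∀ i → ValidAt (Frame i) (imp (psubst substitution θ) ψ)
    χ⇒ψ-valid θ θ⊆q ψ θ⇒ψ* i V = implication-intro λ χ✓ →
      let θ✓ = trans (pointValuation-psubst ≤-refl i V false θ θ⊆q) χ✓
          guard✓ = All.lookup (pconj-true⁻ v (map (guard ψ) (allFin k)) (implication-elim (θ⇒ψ* v) θ✓))
                              (∈-map⁺ (guard ψ) (∈-allFin i))
      in trans (sym (pointValuation-translate ≤-refl i V false ψ))
               (implication-elim guard✓ (pointValuation-profile ≤-refl i V false))
      where v = pointValuation (k * N) i V false

    msig-psubst-substitution : ∀ θ → psig θ ⊆ qAtoms → msig (psubst substitution θ) ⊆ σ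
    msig-psubst-substitution θ θ⊆q a∈ with c , c∈θ , a∈c ← msig-psubst substitution θ a∈
      with j , _ , refl ← ∈-map⁻ (qAtom ∘ toℕ) (θ⊆q c∈θ) =
      ∈-deduplicate⁻ ℕ._≟_ σ (msig-Ψ (N * N) (∈-lookup j) (subst (λ ψ → _ ∈ msig ψ) (substitution-qAtom j) a∈c))

    psig-translateAt : ∀ base i ψ {c} → c ∈ psig (translateAt base i ψ) → CopyAtom base c
    psig-translateAt base i ψ c∈ = i , Translation.psig-translate (Frame i) (copyAtom base i) (point (Frame i)) ψ c∈

    psig-profile : ∀ base i {c} → c ∈ psig (profile base i) → c ∈ qAtoms ⊎ CopyAtom base c
    psig-profile base i c∈ with entry , entry∈ , c∈entry ← psig-pconj (map (profileEntry base i) (allFin Q)) c∈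
      with j , _ , refl ← ∈-map⁻ (profileEntry base i) entry∈
      with psig-piff (pvar (qAtom (toℕ j))) (translateAt base i (lookup ψs j)) c∈entry
    ...   | inj₁ (here refl) = inj₁ (∈-map⁺ (qAtom ∘ toℕ) (∈-allFin j))
    ...   | inj₂ c∈tr        = inj₂ (psig-translateAt base i (lookup ψs j) c∈tr)

    psig-ψ* : ∀ ψ {c} → c ∈ psig (ψ* ψ) → c ∈ qAtoms ⊎ CopyAtom (k * N) c
    psig-ψ* ψ c∈ with conjunct , conjunct∈ , c∈conjunct ← psig-pconj (map (guard ψ) (allFin k)) c∈
      with i , _ , refl ← ∈-map⁻ (guard ψ) conjunct∈
      with ∈-++⁻ (psig (profile (k * N) i)) c∈conjunct
    ... | inj₁ c∈profile = psig-profile (k * N) i c∈profile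
    ... | inj₂ c∈ψ       = inj₂ (psig-translateAt (k * N) i ψ c∈ψ)

    psize-translateAt : ∀ base i ψ → psize (translateAt base i ψ) ≤ suc (msize ψ * blowup)
    psize-translateAt base i ψ =
      ≤-trans (Translation.psize-translate (Frame i) (copyAtom base i) (point (Frame i)) ψ)
              (s≤s (*-monoʳ-≤ (msize ψ) (*-mono-≤ (Frame≤N i) (s≤s (Frame≤N i)))))

    psize-profileEntry : ∀ base i j → psize (profileEntry base i j) ≤ entryBound
    psize-profileEntry base i j =
      ≤-trans (psize-piff (pvar (qAtom (toℕ j))) (translateAt base i ψ))
              (s≤s (*-monoʳ-≤ 2 (+-monoʳ-≤ 4 (≤-trans (psize-translateAt base i ψ)
                                                      (s≤s (*-monoˡ-≤ blowup ψ≤treeBound))))))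
      where
      ψ = lookup ψs j
      ψ≤treeBound : msize ψ ≤ treeBound
      ψ≤treeBound = ≤-trans (msize-≤ ψ id) (length-msubs-Ψ (N * N) (∈-lookup j))

    psize-profile : ∀ base i → psize (profile base i) ≤ suc (Q * suc entryBound)
    psize-profile base i =
      subst (λ m → psize (profile base i) ≤ suc (m * suc entryBound)) (trans (length-map _ (allFin Q)) (length-allFin Q))
            (psize-pconj (map (profileEntry base i) (allFin Q)) (All.map⁺ (All.tabulate⁺ (psize-profileEntry base i))))

    E : List MForm
    E = top ∷ concatMap msubs ψs

    length-E : length E ≤ suc (treeBound * Q)
    length-E = s≤s (≤-trans (length-concatMap-≤ msubs ψs (All.tabulate (length-msubs-Ψ (N * N))))
                            (≤-reflexive (*-comm Q treeBound)))

    substitution-∈ : ∀ c → substitution c ∈ top ∷ ψs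
    substitution-∈ c with slot c
    ... | zero  = nthOrTop-∈ ψs (payload c)
    ... | suc _ = here refl

    msubs-substitution⊆E : ∀ c → msubs (substitution c) ⊆ E
    msubs-substitution⊆E c with substitution c | substitution-∈ c
    ... | _ | here refl = λ { (here refl) → here refl }
    ... | _ | there ψ∈  = λ χ∈ → there (∈-concatMap⁺ msubs (Any.map (λ { refl → χ∈ }) ψ∈))

  module Implicate (φ : MForm) (σ : Sig) where

    open Profiles σ

    x : ℕ
    x = msize φ

    length-σ₀≤x : σ ⊆ msig φ → length σ₀ ≤ x
    length-σ₀≤x σ⊆ = begin
      length σ₀           ≡⟨ sym (length-map var σ₀) ⟩
      length (map var σ₀) ≤⟨ ≤-msize φ (Unique.map⁺ var-injective (deduplicate-! ℕ._≟_ σ)) vars⊆ ⟩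
      msize φ             ∎
      where
      open ≤-Reasoning
      var-injective : ∀ {a b} → var a ≡ var b → a ≡ b
      var-injective refl = refl
      vars⊆ : map var σ₀ ⊆ msubs φ
      vars⊆ v∈ with a , a∈ , refl ← ∈-map⁻ var v∈ = var-∈-msubs φ (σ⊆ (∈-deduplicate⁻ ℕ._≟_ σ a∈))

    Q≤ : σ ⊆ msig φ → Q ≤ evalPoly Qₚ x
    Q≤ σ⊆ = ≤-trans (length-Ψ (N * N)) (evalPoly-mono Qₚ (length-σ₀≤x σ⊆))

    block : Fin k → PForm
    block i = pand (translateAt 0 i φ) (profile 0 i)

    ξ : PForm
    ξ = pdisj (map block (allFin k))

    psize-block : ∀ i → psize (block i) ≤ suc (suc (x * blowup) + suc (Q * suc entryBound))
    psize-block i = ≤-trans (psize-pand (translateAt 0 i φ) (profile 0 i))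
                            (s≤s (+-mono-≤ (psize-translateAt 0 i φ) (psize-profile 0 i)))

    psize-ξ : σ ⊆ msig φ → psize ξ + 2 ≤ evalPoly Hₚ x
    psize-ξ σ⊆ = begin
      psize ξ + 2
        ≤⟨ +-monoˡ-≤ 2 (psize-pdisj (map block (allFin k)) (All.map⁺ (All.tabulate⁺ psize-block))) ⟩
      suc (suc (length (map block (allFin k)) * suc (suc B))) + 2
        ≡⟨ cong (λ m → suc (suc (m * suc (suc B))) + 2) (trans (length-map block (allFin k)) (length-allFin k)) ⟩
      suc (suc (k * suc (suc B))) + 2
        ≡⟨ arithmetic k x blowup Q entryBound ⟩
      (4 + k * 5) + (k * blowup) * x + (k * suc entryBound) * Q
        ≤⟨ +-monoʳ-≤ ((4 + k * 5) + (k * blowup) * x) (*-monoʳ-≤ (k * suc entryBound) (Q≤ σ⊆)) ⟩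
      (4 + k * 5) + (k * blowup) * x + (k * suc entryBound) * evalPoly Qₚ x
        ≡⟨ sym eval-Hₚ ⟩
      evalPoly Hₚ x ∎
      where
      open ≤-Reasoning
      B = suc (suc (x * blowup) + suc (Q * suc entryBound))
      arithmetic : ∀ k x b q e → suc (suc (k * suc (suc (suc (suc (x * b) + suc (q * suc e)))))) + 2
                                 ≡ (4 + k * 5) + (k * b) * x + (k * suc e) * q
      arithmetic = solve 5 (λ k x b q e →
        con 2 :+ k :* (con 3 :+ ((con 1 :+ x :* b) :+ (con 1 :+ q :* (con 1 :+ e)))) :+ con 2
          := (con 4 :+ k :* con 5) :+ (k :* b) :* x :+ (k :* (con 1 :+ e)) :* q) refl
        where open +-*-Solver
      eval-Hₚ : evalPoly Hₚ x ≡ (4 + k * 5) + (k * blowup) * x + (k * suc entryBound) * evalPoly Qₚ x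
      eval-Hₚ = trans (evalPoly-+ₚ x (constₚ (4 + k * 5) +ₚ (k * blowup) ·ₚ Xₚ) ((k * suc entryBound) ·ₚ Qₚ))
        (cong₂ _+_ (trans (evalPoly-+ₚ x (constₚ (4 + k * 5)) ((k * blowup) ·ₚ Xₚ))
                          (cong₂ _+_ (evalPoly-constₚ x (4 + k * 5))
                                     (trans (evalPoly-·ₚ x (k * blowup) Xₚ) (cong (k * blowup *_) (evalPoly-Xₚ x)))))
                   (evalPoly-·ₚ x (k * suc entryBound) Qₚ))

    length-E≤Gₚ : σ ⊆ msig φ → length E ≤ evalPoly Gₚ x
    length-E≤Gₚ σ⊆ = ≤-trans length-E (≤-trans (s≤s (*-monoʳ-≤ treeBound (Q≤ σ⊆)))
      (≤-reflexive (sym (trans (evalPoly-+ₚ x (constₚ 1) (treeBound ·ₚ Qₚ))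
                               (cong₂ _+_ (evalPoly-constₚ x 1) (evalPoly-·ₚ x treeBound Qₚ))))))

    s : ℕ
    s = evalPoly p₂ x

    eval-p₂ : s ≡ suc (2 * (evalPoly Hₚ x + evalPoly Gₚ x))
    eval-p₂ = trans (evalPoly-+ₚ x (constₚ 1) (2 ·ₚ (Hₚ +ₚ Gₚ)))
                    (cong₂ _+_ (evalPoly-constₚ x 1)
                               (trans (evalPoly-·ₚ x 2 (Hₚ +ₚ Gₚ)) (cong (2 *_) (evalPoly-+ₚ x Hₚ Gₚ))))

    -- f need not be monotone, so ξ is padded to size exactly s = p₂(|φ|).
    padLength : ℕ
    padLength = s ∸ (psize ξ + 2)

    ξ′ : PForm
    ξ′ = pand ξ (negations padLength (pvar padAtom))

    σ′ : List Atom
    σ′ = filter (_∈? psig ξ′) qAtoms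

    σ′⊆ξ′ : σ′ ⊆ psig ξ′
    σ′⊆ξ′ c∈ = proj₂ (∈-filter⁻ (_∈? psig ξ′) {xs = qAtoms} c∈)

    σ′⊆qAtoms : σ′ ⊆ qAtoms
    σ′⊆qAtoms c∈ = proj₁ (∈-filter⁻ (_∈? psig ξ′) {xs = qAtoms} c∈)

    psig-ξ : ∀ {c} → c ∈ psig ξ → c ∈ qAtoms ⊎ CopyAtom 0 c
    psig-ξ c∈ with ¬block , ¬block∈ , c∈¬block ← psig-pconj (map pneg (map block (allFin k))) c∈
      with β , β∈ , refl ← ∈-map⁻ pneg ¬block∈
      with i , _ , refl ← ∈-map⁻ block β∈
      with ∈-++⁻ (psig (translateAt 0 i φ)) c∈¬block
    ...   | inj₁ c∈φ       = inj₂ (psig-translateAt 0 i φ c∈φ)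
    ...   | inj₂ c∈profile = psig-profile 0 i c∈profile

    padAtom∉ξ : padAtom ∉ psig ξ
    padAtom∉ξ pad∈ with psig-ξ pad∈
    ... | inj₁ pad∈q with () ← trans (sym slot-padAtom) (slot-∈-qAtoms pad∈q)
    ... | inj₂ copy with _ , _ , slot≡ ← slot-CopyAtom z≤n copy with () ← trans (sym slot-padAtom) slot≡

    psize-ξ′ : σ ⊆ msig φ → psize ξ′ ≡ s
    psize-ξ′ σ⊆ = begin
      psize ξ′                              ≡⟨ psize-pad ξ padLength padAtom padAtom∉ξ ⟩
      suc (psize ξ + suc padLength)         ≡⟨ sym (+-suc (psize ξ) (suc padLength)) ⟩
      psize ξ + (2 + padLength)             ≡⟨ sym (+-assoc (psize ξ) 2 padLength) ⟩
      psize ξ + 2 + (s ∸ (psize ξ + 2))     ≡⟨ m+[n∸m]≡n ξ+2≤s ⟩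
      s                                     ∎
      where
      open ≡-Reasoning
      ξ+2≤s : psize ξ + 2 ≤ s
      ξ+2≤s = ≤-trans (psize-ξ σ⊆) (≤-trans (m≤m+n _ (evalPoly Gₚ x))
                (≤-trans (m≤m+n _ _) (≤-trans (n≤1+n _) (≤-reflexive (sym eval-p₂)))))

    shared-atoms : ∀ ψ {c} → c ∈ psig (ψ* ψ) → c ∈ psig ξ′ → c ∈ σ′
    shared-atoms ψ {c} c∈ψ* c∈ξ′ = ∈-filter⁺ (_∈? psig ξ′) c∈q c∈ξ′
      where
      c∈q : c ∈ qAtoms
      c∈q with psig-ψ* ψ c∈ψ*
      ... | inj₁ c∈q = c∈q
      ... | inj₂ z-copy with o , _ , slot≡ ← slot-CopyAtom ≤-refl z-copy with ∈-++⁻ (psig ξ) c∈ξ′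
      ...   | inj₂ c∈pad with refl ← psig-negations-∈ padLength padAtom c∈pad with () ← trans (sym slot-padAtom) slot≡
      ...   | inj₁ c∈ξ with psig-ξ c∈ξ
      ...     | inj₁ c∈q with () ← trans (sym (slot-∈-qAtoms c∈q)) slot≡
      ...     | inj₂ y-copy with o′ , o′<kN , slot≡′ ← slot-CopyAtom z≤n y-copy =
        ⊥-elim (<⇒≱ o′<kN (≤-trans (m≤m+n (k * N) o)
                                   (≤-reflexive (suc-injective (suc-injective (trans (sym slot≡) slot≡′))))))

    φ⇒χ-valid : ∀ θ → psig θ ⊆ σ′ → Tautology (pimp ξ′ θ) →
      ∀ i → ValidAt (Frame i) (imp φ (psubst substitution θ))
    φ⇒χ-valid θ θ⊆σ′ ξ′⇒θ i V = implication-intro λ φ✓ →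
      trans (sym (pointValuation-psubst z≤n i V padBit θ (σ′⊆qAtoms ∘ θ⊆σ′)))
            (implication-elim (ξ′⇒θ v) (cong₂ _∧_ (ξ✓ φ✓) pad✓))
      where
      padBit = proj₁ (negations-eval padLength (pvar padAtom) true)
      v = pointValuation 0 i V padBit
      ξ✓ : meval (Frame i) V (point (Frame i)) φ ≡ true → peval v ξ ≡ true
      ξ✓ φ✓ = pdisj-true⁺ v (Any.map (λ { refl → block✓ }) (∈-map⁺ block (∈-allFin i)))
        where
        block✓ : peval v (block i) ≡ true
        block✓ = cong₂ _∧_ (trans (pointValuation-translate z≤n i V padBit φ) φ✓) (pointValuation-profile z≤n i V padBit)
      pad✓ : peval v (negations padLength (pvar padAtom)) ≡ true
      pad✓ = proj₂ (negations-eval padLength (pvar padAtom) true) v (pointValuation-padAtom z≤n i V padBit)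

    ξ′⇒ψ* : ∀ ψ → msig ψ ⊆ σ → (∀ i → ValidAt (Frame i) (imp φ ψ)) → Tautology (pimp ξ′ (ψ* ψ))
    ξ′⇒ψ* ψ ψ⊆σ φ⇒ψ v = implication-intro λ ξ′✓ →
      let i , _ , block✓ = find (Any.map⁻ (pdisj-true⁻ v (map block (allFin k)) (proj₁ (∧-true⁻ ξ′✓))))
      in pconj-true⁺ v (map (guard ψ) (allFin k))
                     (All.map⁺ (All.tabulate⁺ λ i′ → implication-intro (transfer i block✓ i′)))
      where
      transfer : ∀ i → peval v (block i) ≡ true → ∀ i′ → peval v (profile (k * N) i′) ≡ true →
        peval v (translateAt (k * N) i′ ψ) ≡ true
      transfer i block✓ i′ profile✓ =
        trans (readOff-translate (k * N) i′ v ψ)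
              (trans (sym (Agree-N²⇒σ-equivalent (Frame≤N i) (Frame≤N i′) y≈z ψ (∈-deduplicate⁺ ℕ._≟_ ∘ ψ⊆σ)))
                     (implication-elim (φ⇒ψ i (valuation (readOff 0 i v))) φ✓))
        where
        φ✓ = trans (sym (readOff-translate 0 i v φ)) (proj₁ (∧-true⁻ block✓))
        q≡ : ∀ base i → peval v (profile base i) ≡ true →
          ∀ j → v (qAtom (toℕ j)) ≡ eval (readOff base i v) (point (Frame i)) (lookup ψs j)
        q≡ base i profile✓ j = trans (profile-true⁻ base i v profile✓ j) (readOff-translate base i v (lookup ψs j))
        y≈z = agree (All-lookup⁻ ψs λ j →
                trans (sym (q≡ 0 i (proj₂ (∧-true⁻ block✓)) j)) (q≡ (k * N) i′ profile✓ j))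

    strongest-implicate : ∀ f → UniformInterpolantsBoundedBy f → σ ⊆ msig φ →
      Σ MForm λ χ → IsStrongestImplicate (Log Fs) σ φ χ × msize χ ≤ evalPoly p₁ (f s)
    strongest-implicate f interpolate σ⊆
      with θ , (θ⊆σ′ , ξ′⇒θ , θ-strongest) , θ≤ ← interpolate ξ′ σ′ σ′⊆ξ′ =
      χ , (msig-psubst-substitution θ θ⊆q , Log⁺ {imp φ χ} (φ⇒χ-valid θ θ⊆σ′ ξ′⇒θ) , χ-strongest) , χ≤
      where
      θ⊆q : psig θ ⊆ qAtoms
      θ⊆q = σ′⊆qAtoms ∘ θ⊆σ′
      χ = psubst substitution θ
      χ-strongest : ∀ ψ → msig ψ ⊆ σ → Log Fs (imp φ ψ) → Log Fs (imp χ ψ)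
      χ-strongest ψ ψ⊆σ φ⇒ψ =
        Log⁺ {imp χ ψ} (χ⇒ψ-valid θ θ⊆q ψ
          (θ-strongest (ψ* ψ) (shared-atoms ψ) (ξ′⇒ψ* ψ ψ⊆σ (Log⁻ {imp φ ψ} φ⇒ψ))))
      -- The chain formula of size s shows f s > Hₚ x + Gₚ x, which absorbs the cost of substituting ψs.
      E≤fs : length E ≤ f s
      E≤fs = begin
        length E                                    ≤⟨ length-E≤Gₚ σ⊆ ⟩
        evalPoly Gₚ x                               ≤⟨ m≤n+m _ (evalPoly Hₚ x) ⟩
        evalPoly Hₚ x + evalPoly Gₚ x               <⟨ uniform-interpolation-bound-grows {f} interpolate _ ⟩
        f (suc (2 * (evalPoly Hₚ x + evalPoly Gₚ x))) ≡⟨ cong f (sym eval-p₂) ⟩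
        f s                                         ∎
        where open ≤-Reasoning
      χ≤ : msize χ ≤ evalPoly p₁ (f s)
      χ≤ = begin
        msize χ            ≤⟨ msize-psubst substitution E θ (λ {c} _ → msubs-substitution⊆E c) ⟩
        psize θ + length E ≤⟨ +-mono-≤ (≤-trans θ≤ (≤-reflexive (cong f (psize-ξ′ σ⊆)))) E≤fs ⟩
        f s + f s          ≡⟨ cong (f s +_) (sym (+-identityʳ (f s))) ⟩
        2 * f s            ≡⟨ sym (trans (evalPoly-·ₚ (f s) 2 Xₚ) (cong (2 *_) (evalPoly-Xₚ (f s)))) ⟩
        evalPoly p₁ (f s)  ∎
        where open ≤-Reasoning

mainTheorem2 : (L : MForm → Set) → QuasiNormal L → Tabular L →
    Σ Poly λ p₁ → Σ Poly λ p₂ →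
      (f : ℕ → ℕ) →
      (∀ (ξ : PForm) (σ : Sig) → σ ⊆ psig ξ →
         Σ PForm λ χ → IsUniformInterpolant σ ξ χ × (psize χ ≤ f (psize ξ))) →
      ∀ (φ : MForm) (σ : Sig) → σ ⊆ msig φ →
        Σ MForm λ χ → IsStrongestImplicate L σ φ χ ×
          (msize χ ≤ evalPoly p₁ (f (evalPoly p₂ (msize φ))))
mainTheorem2 L _ (Fs , L⇔Log) = p₁ , p₂ , λ f interpolate φ σ σ⊆φ →
  let χ , χ-implicate , χ≤ = Implicate.strongest-implicate φ σ f interpolate σ⊆φ
  in χ , IsStrongestImplicate-cong (proj₂ ∘ L⇔Log) (proj₁ ∘ L⇔Log) χ-implicate , χ≤
  where open Construction Fs
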